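{- Let $p_1,\dots,p_k\in\mathbb{K}[x_1,\dots,x_d]$ be pure difference binomials and let $L\subseteq\mathbb{Z}^d$ be the lattice spanned by their exponent vectors (with $L=\{0\}$ if $k=0$). Then there exists a linear loop with a diagonal update matrix $M\in\mathbb{Q}^{d\times d}$ whose invariant ideal is $I_{\mathrm{Sat}(L)}$.
   Context: $\mathbb{K}=\overline{\mathbb{Q}}$. A pure difference binomial is $x^{\alpha}-x^{\beta}$ with $\alpha,\beta\in\mathbb{N}^d$; its exponent vector is $\alpha-\beta$. $\mathrm{Sat}(L)=\{u\in\mathbb{Z}^d: cu\in L\text{ for some } c\in\mathbb{Z}\setminus\{0\}\}$, and for a lattice $L'\subseteq\mathbb{Z}^d$, $I_{L'}=\langle x^{\alpha}-x^{\beta}:\alpha,\beta\in\mathbb{N}^d,\ \alpha-\beta\in L'\rangle$. A linear loop with initial vector $s\in\mathbb{Q}^d$ and update matrix $M\in\mathbb{Q}^{d\times d}$ produces the values $x(n)=M^n s$, $n\ge0$. A polynomial $P\in\mathbb{K}[x]$ is an invariant of the loop if $P(x(n))=0$ for all $n\ge0$; the invariant ideal is the ideal of all invariants. -}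

module Defs where

open import Level using (Level; _⊔_)
open import Data.Nat as ℕ using (ℕ; zero; suc; _≥_)
open import Data.Integer as ℤ using (ℤ)
open import Data.Rational as ℚ using (ℚ)
import Data.Rational.Properties as ℚP
open import Data.Fin using (Fin; toℕ)
open import Data.Vec as Vec using (Vec)
import Data.Vec.Properties as VecP
open import Data.List as List using (List; []; _∷_; _++_; length)
open import Data.Product using (Σ; ∃; ∃-syntax; _×_; _,_)
open import Relation.Nullary using (¬_; yes; no)
open import Relation.Binary.PropositionalEquality using (_≡_)
open import Algebra.Bundles using (CommutativeRing)
open import Algebra.Morphism.Structures using (IsRingHomomorphism)
open import Function.Bundles using (_⇔_)
open import Data.List.Relation.Unary.All using (All)

sumFin : ∀ {a} {A : Set a} → A → (A → A → A) → ∀ n → (Fin n → A) → A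
sumFin z _+_ zero    f = z
sumFin z _+_ (suc n) f = f Fin.zero + sumFin z _+_ n (λ i → f (Fin.suc i))
  where import Data.Fin as Fin

Exp : ℕ → Set
Exp d = Vec ℕ d

ZVec : ℕ → Set
ZVec d = Vec ℤ d

expVec : ∀ {d} → Exp d → Exp d → ZVec d
expVec α β = Vec.zipWith (λ a b → ℤ.+ a ℤ.- ℤ.+ b) α β

ZSet : ℕ → Set₁
ZSet d = ZVec d → Set

Span : ∀ {d} k → (Fin k → ZVec d) → ZSet d
Span {d} k v u =
  Σ (Fin k → ℤ) λ c →
    u ≡ sumFin (Vec.replicate d (ℤ.+ 0)) (Vec.zipWith ℤ._+_) k
               (λ i → Vec.map (c i ℤ.*_) (v i))

Sat : ∀ {d} → ZSet d → ZSet d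
Sat L u = ∃[ c ] (¬ (c ≡ ℤ.+ 0) × L (Vec.map (c ℤ.*_) u))

module _ {c ℓ} (K : CommutativeRing c ℓ) where
  open CommutativeRing K

  IsField : Set (c ⊔ ℓ)
  IsField = (¬ (0# ≈ 1#)) × (∀ x → ¬ (x ≈ 0#) → ∃[ y ] (x * y ≈ 1#))

  -- univariate polynomials as coefficient lists (constant term first)
  evalU : List Carrier → Carrier → Carrier
  evalU []       x = 0#
  evalU (a ∷ as) x = a + x * evalU as x

  NonConstant : List Carrier → Set ℓ
  NonConstant as = ∃[ i ] (toℕ {length as} i ≥ 1 × ¬ (List.lookup as i ≈ 0#))

  IsAlgClosed : Set (c ⊔ ℓ)
  IsAlgClosed = ∀ as → NonConstant as → ∃[ x ] (evalU as x ≈ 0#)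

-- Multivariate polynomials over K in d variables, as finite lists of
-- terms (coefficient, exponent vector); equality is coefficientwise.

module Poly {c ℓ} (K : CommutativeRing c ℓ) (d : ℕ) where
  open CommutativeRing K

  Poly : Set c
  Poly = List (Carrier × Exp d)

  coeff : Poly → Exp d → Carrier
  coeff []              α = 0#
  coeff ((a , β) ∷ ts) α with VecP.≡-dec ℕ._≟_ β α
  ... | yes _ = a + coeff ts α
  ... | no  _ = coeff ts α

  _≈P_ : Poly → Poly → Set ℓ
  P ≈P Q = ∀ α → coeff P α ≈ coeff Q α

  0P : Poly
  0P = []

  _+P_ : Poly → Poly → Poly
  P +P Q = P ++ Q

  -P_ : Poly → Poly
  -P P = List.map (λ { (a , α) → (- a , α) }) P

  _*P_ : Poly → Poly → Poly
  P *P Q = List.concatMap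
             (λ { (a , α) → List.map (λ { (b , β) → (a * b , Vec.zipWith ℕ._+_ α β) }) Q })
             P

  mono : Exp d → Poly
  mono α = (1# , α) ∷ []

  binom : Exp d → Exp d → Poly
  binom α β = mono α +P (-P mono β)

  powK : Carrier → ℕ → Carrier
  powK x zero    = 1#
  powK x (suc n) = x * powK x n

  evalMono : Exp d → (Fin d → Carrier) → Carrier
  evalMono α x = sumFin 1# _*_ d (λ i → powK (x i) (Vec.lookup α i))

  eval : Poly → (Fin d → Carrier) → Carrier
  eval []             x = 0#
  eval ((a , α) ∷ ts) x = a * evalMono α x + eval ts x

  -- the lattice ideal I_{L'} = ⟨ x^α - x^β : α - β ∈ L' ⟩ :
  -- P ∈ I_{L'} iff P is a finite K[x]-combination of such binomials
  InLatticeIdeal : ZSet d → Poly → Set (c ⊔ ℓ)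
  InLatticeIdeal L' P =
    Σ (List (Poly × Exp d × Exp d)) λ gens →
      All (λ { (q , α , β) → L' (expVec α β) }) gens ×
      (P ≈P List.foldr (λ { (q , α , β) acc → (q *P binom α β) +P acc }) 0P gens)

QMat : ℕ → Set
QMat d = Fin d → Fin d → ℚ

QVec : ℕ → Set
QVec d = Fin d → ℚ

mulMV : ∀ {d} → QMat d → QVec d → QVec d
mulMV {d} M v i = sumFin (ℚ.0ℚ) ℚ._+_ d (λ j → M i j ℚ.* v j)

loopVal : ∀ {d} → QMat d → QVec d → ℕ → QVec d
loopVal M s zero    = s
loopVal M s (suc n) = mulMV M (loopVal M s n)

IsDiagonal : ∀ {d} → QMat d → Set
IsDiagonal M = ∀ i j → ¬ (i ≡ j) → M i j ≡ ℚ.0ℚ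

module Loop {c ℓ} (K : CommutativeRing c ℓ) (d : ℕ) (ι : ℚ → CommutativeRing.Carrier K) where
  open CommutativeRing K
  open Poly K d

  IsInvariant : QVec d → QMat d → Poly → Set ℓ
  IsInvariant s M P = ∀ n → eval P (λ i → ι (loopVal M s n i)) ≈ 0#

  InvIdealIs : QVec d → QMat d → ZSet d → Set (c ⊔ ℓ)
  InvIdealIs s M L' = ∀ P → IsInvariant s M P ⇔ InLatticeIdeal L' P

ℚ-to : ∀ {c ℓ} → CommutativeRing c ℓ → Set c
ℚ-to K = ℚ → CommutativeRing.Carrier K

-- Take an integer matrix A whose kernel in ℤ^d is Sat(L) (built by adding the generators of L
-- one at a time) and pairwise coprime p₁, …, pₘ ≥ 2, which are multiplicatively independent.
-- The diagonal loop started at (1, …, 1) with the eigenvalues μᵢ = ∏ⱼ pⱼ^Aⱼᵢ ∈ ℚ reaches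
-- x(n) = (μᵢⁿ)ᵢ, where the monomial x^α takes the value (μ^α)ⁿ; and μ^α = μ^β iff A α = A β
-- iff α - β ∈ Sat(L). Hence P = Σ aₜ x^αₜ is invariant iff Σ aₜ (μ^αₜ)ⁿ = 0 for all n, which
-- by a Vandermonde argument holds iff the coefficients of P add up to zero on every class
-- α + Sat(L); and that is exactly the condition for P to be a combination of binomials
-- x^α - x^β with α - β ∈ Sat(L).

module Submission where

open import Defs
open import Algebra.Bundles using (Monoid; CommutativeSemiring; CommutativeRing)
open import Algebra.Morphism.Structures using (IsRingHomomorphism)
import Algebra.Properties.Group
open import Data.Bool using (if_then_else_)
open import Data.Empty using (⊥-elim)
open import Data.Fin as Fin using (Fin; zero; suc)
import Data.Fin.Properties as FinP
open import Data.Integer as ℤ using (ℤ; 0ℤ; 1ℤ; +_)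
import Data.Integer.Properties as ℤP
open import Data.Integer.Tactic.RingSolver using (solve-∀)
open import Data.List as List using (List; []; _∷_; _++_; length)
import Data.List.Properties as ListP
open import Data.List.Membership.Propositional using (_∈_)
open import Data.List.Relation.Unary.All as All using (All; []; _∷_)
import Data.List.Relation.Unary.All.Properties as AllP
open import Data.List.Relation.Unary.Any using (here; there)
open import Data.Nat as ℕ using (ℕ)
import Data.Nat.Properties as ℕP
open import Data.Product using (Σ; ∃; ∃₂; _×_; _,_; proj₂)
open import Data.Rational as ℚ using (ℚ; 0ℚ; 1ℚ)
import Data.Rational.Properties as ℚP
open import Data.Rational.Properties using (+-*-rawRing)
open import Data.Sum using (inj₁; inj₂)
open import Data.Vec as Vec using (Vec; lookup)
import Data.Vec.Properties as VecP
import Data.Vec.Functional as Vector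
open import Function using (id; _∘_; _∘₂_; _⇔_; mk⇔; Equivalence)
open import Function.Properties.Equivalence using () renaming (sym to ⇔-sym; trans to ⇔-trans)
open import Level using (_⊔_)
open import Relation.Binary.Definitions using (DecidableEquality)
import Relation.Binary.PropositionalEquality as ≡
open ≡ using (_≡_; _≢_)
open import Relation.Nullary using (¬_; yes; no; does; ¬?)

open import Algebra.Definitions.RawMonoid ℕ.+-0-rawMonoid using () renaming (sum to ∑ℕ)

sumFin≡foldr : ∀ {a} {A : Set a} (z : A) (_∙_ : A → A → A) n (f : Fin n → A) →
               sumFin z _∙_ n f ≡ Vector.foldr _∙_ z f
sumFin≡foldr z _∙_ ℕ.zero    f = ≡.refl
sumFin≡foldr z _∙_ (ℕ.suc n) f = ≡.cong (f zero ∙_) (sumFin≡foldr z _∙_ n (f ∘ suc))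

Vec-≡ : ∀ {a} {A : Set a} {n} {u v : Vec A n} → (∀ i → lookup u i ≡ lookup v i) → u ≡ v
Vec-≡ {u = u} {v} eq = ≡.trans (≡.sym (VecP.tabulate∘lookup u))
                               (≡.trans (VecP.tabulate-cong eq) (VecP.tabulate∘lookup v))

module _ {c ℓ} (M : Monoid c ℓ) where
  open Monoid M
  open import Algebra.Definitions.RawMonoid rawMonoid using (sum)

  sum-supportedAt : ∀ {n} (f : Fin n → Carrier) j → (∀ i → i ≢ j → f i ≈ ε) → sum f ≈ f j
  sum-supportedAt {ℕ.suc n} f zero vanish =
    trans (∙-congˡ (sum-zero (λ i → vanish (suc i) λ ()))) (identityʳ (f zero))
    where
    sum-zero : ∀ {n} {g : Fin n → Carrier} → (∀ i → g i ≈ ε) → sum g ≈ ε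
    sum-zero {ℕ.zero}  g≈ε = refl
    sum-zero {ℕ.suc n} g≈ε = trans (∙-cong (g≈ε zero) (sum-zero (g≈ε ∘ suc))) (identityˡ ε)
  sum-supportedAt {ℕ.suc n} f (suc j) vanish =
    trans (∙-congʳ (vanish zero λ ()))
          (trans (identityˡ _)
                 (sum-supportedAt (f ∘ suc) j λ i i≢j → vanish (suc i) (i≢j ∘ FinP.suc-injective)))

module Products {c ℓ} (R : CommutativeSemiring c ℓ) where
  open CommutativeSemiring R hiding (zero)
  open import Algebra.Properties.CommutativeSemiring.Exp R public
    using (_^_; ^-congˡ; ^-homo-*; ^-assocʳ; ^-distrib-*)
  open import Algebra.Properties.CommutativeMonoid.Sum *-commutativeMonoid public
    using () renaming (sum to ∏; sum-cong-≋ to ∏-cong; ∑-distrib-+ to ∏-distrib-*; ∑-comm to ∏-comm)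

  monomial : ∀ {d} → (Fin d → Carrier) → Exp d → Carrier
  monomial x α = ∏ (λ i → x i ^ lookup α i)

  1^≈1 : ∀ k → 1# ^ k ≈ 1#
  1^≈1 ℕ.zero    = refl
  1^≈1 (ℕ.suc k) = trans (*-identityˡ _) (1^≈1 k)

  ∏-^ : ∀ {n} (f : Fin n → Carrier) k → ∏ (λ i → f i ^ k) ≈ ∏ f ^ k
  ∏-^ {ℕ.zero}  f k = sym (1^≈1 k)
  ∏-^ {ℕ.suc n} f k = trans (*-congˡ (∏-^ (f ∘ suc) k)) (sym (^-distrib-* (f zero) _ k))

  ^-∑ℕ : ∀ x {n} (e : Fin n → ℕ) → x ^ ∑ℕ e ≈ ∏ (λ i → x ^ e i)
  ^-∑ℕ x {ℕ.zero}  e = refl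
  ^-∑ℕ x {ℕ.suc n} e = trans (^-homo-* x (e zero) _) (*-congˡ (^-∑ℕ x (e ∘ suc)))

  monomial-+ : ∀ {d} (x : Fin d → Carrier) α β →
               monomial x (Vec.zipWith ℕ._+_ α β) ≈ monomial x α * monomial x β
  monomial-+ x α β =
    trans (∏-cong (λ i → trans (reflexive (≡.cong (x i ^_) (VecP.lookup-zipWith ℕ._+_ i α β)))
                               (^-homo-* (x i) (lookup α i) (lookup β i))))
          (∏-distrib-* (λ i → x i ^ lookup α i) (λ i → x i ^ lookup β i))

  monomial-^ : ∀ {d} (x : Fin d → Carrier) n α → monomial (λ i → x i ^ n) α ≈ monomial x α ^ n
  monomial-^ x n α =
    trans (∏-cong (λ i → trans (^-assocʳ (x i) n (lookup α i))
                               (trans (reflexive (≡.cong (x i ^_) (ℕP.*-comm n (lookup α i))))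
                                      (sym (^-assocʳ (x i) (lookup α i) n)))))
          (∏-^ (λ i → x i ^ lookup α i) n)

module ProductHomomorphism {a b ℓa ℓb} (R : CommutativeSemiring a ℓa) (S : CommutativeSemiring b ℓb)
  (h : CommutativeSemiring.Carrier R → CommutativeSemiring.Carrier S)
  (h-1 : CommutativeSemiring._≈_ S (h (CommutativeSemiring.1# R)) (CommutativeSemiring.1# S))
  (h-* : ∀ x y → CommutativeSemiring._≈_ S (h (CommutativeSemiring._*_ R x y))
                                             (CommutativeSemiring._*_ S (h x) (h y))) where
  open CommutativeSemiring S hiding (zero)
  private
    module R = Products R
    module S = Products S

  h-^ : ∀ x n → h (x R.^ n) ≈ h x S.^ n
  h-^ x ℕ.zero    = h-1
  h-^ x (ℕ.suc n) = trans (h-* x _) (*-congˡ (h-^ x n))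

  h-∏ : ∀ {n} (f : Fin n → _) → h (R.∏ f) ≈ S.∏ (h ∘ f)
  h-∏ {ℕ.zero}  f = h-1
  h-∏ {ℕ.suc n} f = trans (h-* (f zero) _) (*-congˡ (h-∏ (f ∘ suc)))

  h-monomial : ∀ {d} (x : Fin d → _) α → h (R.monomial x α) ≈ S.monomial (h ∘ x) α
  h-monomial x α = trans (h-∏ (λ i → x i R.^ lookup α i)) (S.∏-cong (λ i → h-^ (x i) (lookup α i)))

module IntegerMatrices where
  open import Algebra.Properties.Semiring.Sum ℤP.+-*-semiring
    using (sum; sum-cong-≋; ∑-distrib-+; *-distribˡ-sum)
  open import Algebra.Properties.CommutativeSemigroup ℤP.*-commutativeSemigroup using (x∙yz≈y∙xz)
  open ≡.≡-Reasoning

  Mat : ℕ → ℕ → Set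
  Mat m d = Fin m → Fin d → ℤ

  infix 8 _·_
  _·_ : ∀ {m d} → Mat m d → ZVec d → Fin m → ℤ
  (A · u) j = sum (λ i → A j i ℤ.* lookup u i)

  Ker : ∀ {m d} → Mat m d → ZSet d
  Ker A u = ∀ j → (A · u) j ≡ 0ℤ

  toZVec : ∀ {d} → Exp d → ZVec d
  toZVec = Vec.map +_

  ·-zipWith-+ : ∀ {m d} (A : Mat m d) u v j →
                (A · Vec.zipWith ℤ._+_ u v) j ≡ (A · u) j ℤ.+ (A · v) j
  ·-zipWith-+ A u v j =
    ≡.trans (sum-cong-≋ pointwise) (∑-distrib-+ (λ i → A j i ℤ.* lookup u i) (λ i → A j i ℤ.* lookup v i))
    where
    pointwise : ∀ i → A j i ℤ.* lookup (Vec.zipWith ℤ._+_ u v) i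
                    ≡ A j i ℤ.* lookup u i ℤ.+ A j i ℤ.* lookup v i
    pointwise i = ≡.trans (≡.cong (A j i ℤ.*_) (VecP.lookup-zipWith ℤ._+_ i u v))
                          (ℤP.*-distribˡ-+ (A j i) _ _)

  ·-map-* : ∀ {m d} (A : Mat m d) c u j → (A · Vec.map (c ℤ.*_) u) j ≡ c ℤ.* (A · u) j
  ·-map-* A c u j =
    ≡.trans (sum-cong-≋ pointwise) (≡.sym (*-distribˡ-sum c (λ i → A j i ℤ.* lookup u i)))
    where
    pointwise : ∀ i → A j i ℤ.* lookup (Vec.map (c ℤ.*_) u) i ≡ c ℤ.* (A j i ℤ.* lookup u i)
    pointwise i = ≡.trans (≡.cong (A j i ℤ.*_) (VecP.lookup-map i (c ℤ.*_) u))
                          (x∙yz≈y∙xz (A j i) c (lookup u i))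

  sum-neg : ∀ {n} (f : Fin n → ℤ) → sum (λ i → ℤ.- f i) ≡ ℤ.- sum f
  sum-neg f = begin
    sum (λ i → ℤ.- f i)        ≡⟨ sum-cong-≋ (λ i → ≡.sym (ℤP.-1*i≡-i (f i))) ⟩
    sum (λ i → ℤ.- 1ℤ ℤ.* f i) ≡⟨ *-distribˡ-sum (ℤ.- 1ℤ) f ⟨
    ℤ.- 1ℤ ℤ.* sum f           ≡⟨ ℤP.-1*i≡-i (sum f) ⟩
    ℤ.- sum f                  ∎

  ·-expVec : ∀ {m d} (A : Mat m d) (α β : Exp d) j →
             (A · expVec α β) j ≡ (A · toZVec α) j ℤ.- (A · toZVec β) j
  ·-expVec A α β j = begin
    (A · expVec α β) j                  ≡⟨ sum-cong-≋ pointwise ⟩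
    sum (λ i → f i ℤ.+ ℤ.- g i)         ≡⟨ ∑-distrib-+ f (λ i → ℤ.- g i) ⟩
    sum f ℤ.+ sum (λ i → ℤ.- g i)       ≡⟨ ≡.cong (λ x → sum f ℤ.+ x) (sum-neg g) ⟩
    sum f ℤ.- sum g                     ∎
    where
    f g : Fin _ → ℤ
    f i = A j i ℤ.* lookup (toZVec α) i
    g i = A j i ℤ.* lookup (toZVec β) i
    distrib : ∀ a x y → a ℤ.* (x ℤ.- y) ≡ a ℤ.* x ℤ.+ ℤ.- (a ℤ.* y)
    distrib = solve-∀
    pointwise : ∀ i → A j i ℤ.* lookup (expVec α β) i ≡ f i ℤ.+ ℤ.- g i
    pointwise i = ≡.trans (≡.cong (A j i ℤ.*_) (VecP.lookup-zipWith _ i α β))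
                          (≡.trans (distrib (A j i) (+ lookup α i) (+ lookup β i))
                                   (≡.cong₂ (λ x y → A j i ℤ.* x ℤ.+ ℤ.- (A j i ℤ.* y))
                                            (≡.sym (VecP.lookup-map i +_ α))
                                            (≡.sym (VecP.lookup-map i +_ β))))

  Ker-expVec⇔ : ∀ {m d} (A : Mat m d) α β →
                (∀ j → (A · toZVec α) j ≡ (A · toZVec β) j) ⇔ Ker A (expVec α β)
  Ker-expVec⇔ A α β =
    mk⇔ (λ eq j → ≡.trans (·-expVec A α β j) (ℤP.i≡j⇒i-j≡0 (eq j)))
        (λ ker j → ℤP.i-j≡0⇒i≡j _ _ (≡.trans (≡.sym (·-expVec A α β j)) (ker j)))

  pos neg : ℤ → ℕ
  pos (+ n)      = n
  pos ℤ.-[1+ n ] = 0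
  neg (+ n)      = 0
  neg ℤ.-[1+ n ] = ℕ.suc n

  pos-neg : ∀ z → + pos z ℤ.- + neg z ≡ z
  pos-neg (+ n)      = ℤP.+-identityʳ (+ n)
  pos-neg ℤ.-[1+ n ] = ℤP.+-identityˡ ℤ.-[1+ n ]

  infix 8 _⊙_
  _⊙_ : ∀ {m d} → (Fin m → Fin d → ℕ) → Exp d → Fin m → ℕ
  (E ⊙ α) j = ∑ℕ (λ i → E j i ℕ.* lookup α i)

  +-∑ℕ : ∀ {n} (f : Fin n → ℕ) → + ∑ℕ f ≡ sum (λ i → + f i)
  +-∑ℕ {ℕ.zero}  f = ≡.refl
  +-∑ℕ {ℕ.suc n} f =
    ≡.trans (ℤP.pos-+ (f zero) _) (≡.cong (λ t → + f zero ℤ.+ t) (+-∑ℕ (f ∘ suc)))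

  ·-toZVec : ∀ {m d} (A : Mat m d) α j →
             (A · toZVec α) j ≡ + ((pos ∘₂ A) ⊙ α) j ℤ.- + ((neg ∘₂ A) ⊙ α) j
  ·-toZVec A α j = begin
    (A · toZVec α) j                                   ≡⟨ sum-cong-≋ split ⟩
    sum (λ i → + f i ℤ.+ ℤ.- + g i)                    ≡⟨ ∑-distrib-+ (λ i → + f i) (λ i → ℤ.- + g i) ⟩
    sum (λ i → + f i) ℤ.+ sum (λ i → ℤ.- + g i)        ≡⟨ ≡.cong₂ ℤ._+_ (≡.sym (+-∑ℕ f))
                                                            (≡.trans (sum-neg (λ i → + g i))
                                                                     (≡.cong ℤ.-_ (≡.sym (+-∑ℕ g)))) ⟩
    + ∑ℕ f ℤ.- + ∑ℕ g                                  ∎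
    where
    f g : Fin _ → ℕ
    f i = pos (A j i) ℕ.* lookup α i
    g i = neg (A j i) ℕ.* lookup α i
    distrib : ∀ a b x → (a ℤ.- b) ℤ.* x ≡ a ℤ.* x ℤ.+ ℤ.- (b ℤ.* x)
    distrib = solve-∀
    split : ∀ i → A j i ℤ.* lookup (toZVec α) i ≡ + f i ℤ.+ ℤ.- + g i
    split i = begin
      A j i ℤ.* lookup (toZVec α) i
        ≡⟨ ≡.cong₂ ℤ._*_ (≡.sym (pos-neg (A j i))) (VecP.lookup-map i +_ α) ⟩
      (+ pos (A j i) ℤ.- + neg (A j i)) ℤ.* + lookup α i
        ≡⟨ distrib (+ pos (A j i)) (+ neg (A j i)) (+ lookup α i) ⟩
      + pos (A j i) ℤ.* + lookup α i ℤ.+ ℤ.- (+ neg (A j i) ℤ.* + lookup α i)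
        ≡⟨ ≡.cong₂ (λ x y → x ℤ.+ ℤ.- y) (ℤP.pos-* (pos (A j i)) (lookup α i))
                                         (ℤP.pos-* (neg (A j i)) (lookup α i)) ⟨
      + f i ℤ.+ ℤ.- + g i ∎

  ℕ-differences-≡⇔ : ∀ a b c d → (a ℕ.+ d ≡ c ℕ.+ b) ⇔ (+ a ℤ.- + b ≡ + c ℤ.- + d)
  ℕ-differences-≡⇔ a b c d = mk⇔ to from
    where
    widen : ∀ x y z → x ℤ.- y ≡ (x ℤ.+ z) ℤ.- (y ℤ.+ z)
    widen = solve-∀
    narrow : ∀ x y z → (x ℤ.+ y) ℤ.- (y ℤ.+ z) ≡ x ℤ.- z
    narrow = solve-∀
    to : a ℕ.+ d ≡ c ℕ.+ b → + a ℤ.- + b ≡ + c ℤ.- + d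
    to eq = begin
      + a ℤ.- + b                          ≡⟨ widen (+ a) (+ b) (+ d) ⟩
      (+ a ℤ.+ + d) ℤ.- (+ b ℤ.+ + d)      ≡⟨ ≡.cong (λ t → t ℤ.- (+ b ℤ.+ + d)) sums≡ ⟩
      (+ c ℤ.+ + b) ℤ.- (+ b ℤ.+ + d)      ≡⟨ narrow (+ c) (+ b) (+ d) ⟩
      + c ℤ.- + d                          ∎
      where
      sums≡ : + a ℤ.+ + d ≡ + c ℤ.+ + b
      sums≡ = ≡.trans (≡.sym (ℤP.pos-+ a d)) (≡.trans (≡.cong +_ eq) (ℤP.pos-+ c b))
    from : + a ℤ.- + b ≡ + c ℤ.- + d → a ℕ.+ d ≡ c ℕ.+ b
    from eq = ℤP.+-injective (begin
      + (a ℕ.+ d)                          ≡⟨ ℤP.pos-+ a d ⟩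
      + a ℤ.+ + d                          ≡⟨ split (+ a) (+ b) (+ d) ⟩
      (+ a ℤ.- + b) ℤ.+ (+ b ℤ.+ + d)      ≡⟨ ≡.cong (ℤ._+ (+ b ℤ.+ + d)) eq ⟩
      (+ c ℤ.- + d) ℤ.+ (+ b ℤ.+ + d)      ≡⟨ merge (+ c) (+ d) (+ b) ⟩
      + c ℤ.+ + b                          ≡⟨ ℤP.pos-+ c b ⟨
      + (c ℕ.+ b)                          ∎)
      where
      split : ∀ x y z → x ℤ.+ z ≡ (x ℤ.- y) ℤ.+ (y ℤ.+ z)
      split = solve-∀
      merge : ∀ x y z → (x ℤ.- y) ℤ.+ (z ℤ.+ y) ≡ x ℤ.+ z
      merge = solve-∀

module SaturationKernel where
  open import Algebra.Properties.Semiring.Sum ℤP.+-*-semiring using (sum; sum-cong-≋; ∑-distrib-+; *-distribʳ-sum)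
  open import Algebra.Properties.CommutativeSemigroup ℤP.*-commutativeSemigroup using (xy∙z≈xz∙y)
  open IntegerMatrices
  open ≡.≡-Reasoning

  *-cancelˡ-≢0 : ∀ {c a b} → c ≢ 0ℤ → c ℤ.* a ≡ c ℤ.* b → a ≡ b
  *-cancelˡ-≢0 {c} {a} {b} c≢0 = ℤP.*-cancelˡ-≡ c a b {{ℤ.≢-nonZero c≢0}}

  *-≢0 : ∀ {a b} → a ≢ 0ℤ → b ≢ 0ℤ → a ℤ.* b ≢ 0ℤ
  *-≢0 {a} a≢0 b≢0 ab≡0 with ℤP.i*j≡0⇒i≡0∨j≡0 a ab≡0
  ... | inj₁ a≡0 = a≢0 a≡0
  ... | inj₂ b≡0 = b≢0 b≡0

  map-1* : ∀ {d} (u : ZVec d) → Vec.map (1ℤ ℤ.*_) u ≡ u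
  map-1* u = ≡.trans (VecP.map-cong ℤP.*-identityˡ u) (VecP.map-id u)

  ⊆Sat : ∀ {d} {L : ZSet d} {u} → L u → Sat L u
  ⊆Sat {L = L} {u} Lu = 1ℤ , (λ ()) , ≡.subst L (≡.sym (map-1* u)) Lu

  Sat-Span-zero⇔ : ∀ {d} (v : Fin 0 → ZVec d) u → Sat (Span 0 v) u ⇔ (∀ i → lookup u i ≡ 0ℤ)
  Sat-Span-zero⇔ {d} v u = mk⇔ to from
    where
    to : Sat (Span 0 v) u → ∀ i → lookup u i ≡ 0ℤ
    to (c , c≢0 , _ , cu≡0) i = *-cancelˡ-≢0 c≢0 (begin
      c ℤ.* lookup u i              ≡⟨ VecP.lookup-map i (c ℤ.*_) u ⟨
      lookup (Vec.map (c ℤ.*_) u) i ≡⟨ ≡.cong (λ w → lookup w i) cu≡0 ⟩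
      lookup (Vec.replicate d 0ℤ) i ≡⟨ VecP.lookup-replicate i 0ℤ ⟩
      0ℤ                            ≡⟨ ℤP.*-zeroʳ c ⟨
      c ℤ.* 0ℤ                      ∎)
    from : (∀ i → lookup u i ≡ 0ℤ) → Sat (Span 0 v) u
    from u≡0 = ⊆Sat {L = Span 0 v}
      ((λ ()) , Vec-≡ {u = u} λ i → ≡.trans (u≡0 i) (≡.sym (VecP.lookup-replicate i 0ℤ)))

  identity : ∀ {d} → Mat d d
  identity j i = if does (i Fin.≟ j) then 1ℤ else 0ℤ

  identity-· : ∀ {d} u (j : Fin d) → (identity · u) j ≡ lookup u j
  identity-· u j = ≡.trans (sum-supportedAt ℤP.+-0-monoid _ j off-diagonal) (diagonal j)
    where
    off-diagonal : ∀ i → i ≢ j → identity j i ℤ.* lookup u i ≡ 0ℤ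
    off-diagonal i i≢j with i Fin.≟ j
    ... | yes i≡j = ⊥-elim (i≢j i≡j)
    ... | no  _   = ≡.refl
    diagonal : ∀ j → identity j j ℤ.* lookup u j ≡ lookup u j
    diagonal j with j Fin.≟ j
    ... | yes _   = ℤP.*-identityˡ _
    ... | no  j≢j = ⊥-elim (j≢j ≡.refl)

  Ker-identity⇔ : ∀ {d} u → Ker (identity {d}) u ⇔ (∀ i → lookup u i ≡ 0ℤ)
  Ker-identity⇔ u = mk⇔ (λ ker i → ≡.trans (≡.sym (identity-· u i)) (ker i))
                        (λ u≡0 i → ≡.trans (identity-· u i) (u≡0 i))

  Proportional : ∀ {m} → (Fin m → ℤ) → (Fin m → ℤ) → Set
  Proportional x w = ∃₂ λ c e → c ≢ 0ℤ × (∀ j → c ℤ.* x j ≡ e ℤ.* w j)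

  Span-suc : ∀ {d k} (v : Fin (ℕ.suc k) → ZVec d) e {w} → Span k (v ∘ suc) w →
             Span (ℕ.suc k) v (Vec.zipWith ℤ._+_ (Vec.map (e ℤ.*_) (v zero)) w)
  Span-suc v e (γ , w≡) = e Vector.∷ γ , ≡.cong (Vec.zipWith ℤ._+_ (Vec.map (e ℤ.*_) (v zero))) w≡

  rescale : ∀ {d} a c e (u v : ZVec d) →
            Vec.map ((a ℤ.* c) ℤ.*_) u
              ≡ Vec.zipWith ℤ._+_ (Vec.map ((a ℤ.* e) ℤ.*_) v)
                  (Vec.map (a ℤ.*_) (Vec.zipWith ℤ._+_ (Vec.map (c ℤ.*_) u) (Vec.map (ℤ.- e ℤ.*_) v)))
  rescale a c e Vec.[]      Vec.[]      = ≡.refl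
  rescale a c e (x Vec.∷ u) (y Vec.∷ v) = ≡.cong₂ Vec._∷_ (distribute a c e x y) (rescale a c e u v)
    where
    distribute : ∀ a c e x y →
                 (a ℤ.* c) ℤ.* x ≡ (a ℤ.* e) ℤ.* y ℤ.+ a ℤ.* (c ℤ.* x ℤ.+ ℤ.- e ℤ.* y)
    distribute = solve-∀

  module _ {m d k} (v : Fin (ℕ.suc k) → ZVec d) (A : Mat m d)
           (ker⇔ : ∀ u → Ker A u ⇔ Sat (Span k (v ∘ suc)) u) where

    Sat-Span-suc⇒Proportional : ∀ u → Sat (Span (ℕ.suc k) v) u → Proportional (A · u) (A · v zero)
    Sat-Span-suc⇒Proportional u (c , c≢0 , γ , cu≡) = c , γ zero , c≢0 , λ j → begin
      c ℤ.* (A · u) j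
        ≡⟨ ·-map-* A c u j ⟨
      (A · Vec.map (c ℤ.*_) u) j
        ≡⟨ ≡.cong (λ z → (A · z) j) cu≡ ⟩
      (A · Vec.zipWith ℤ._+_ (Vec.map (γ zero ℤ.*_) (v zero)) rest) j
        ≡⟨ ·-zipWith-+ A (Vec.map (γ zero ℤ.*_) (v zero)) rest j ⟩
      (A · Vec.map (γ zero ℤ.*_) (v zero)) j ℤ.+ (A · rest) j
        ≡⟨ ≡.cong₂ ℤ._+_ (·-map-* A (γ zero) (v zero) j)
                         (Equivalence.from (ker⇔ rest) (⊆Sat {L = Span k (v ∘ suc)} (γ ∘ suc , ≡.refl)) j) ⟩
      γ zero ℤ.* (A · v zero) j ℤ.+ 0ℤ
        ≡⟨ ℤP.+-identityʳ _ ⟩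
      γ zero ℤ.* (A · v zero) j ∎
      where
      rest : ZVec d
      rest = sumFin (Vec.replicate d 0ℤ) (Vec.zipWith ℤ._+_) k (λ i → Vec.map (γ (suc i) ℤ.*_) (v (suc i)))

    Proportional⇒Sat-Span-suc : ∀ u → Proportional (A · u) (A · v zero) → Sat (Span (ℕ.suc k) v) u
    Proportional⇒Sat-Span-suc u (c , e , c≢0 , cAu≡ew) = lift (Equivalence.to (ker⇔ z) Az≡0)
      where
      z = Vec.zipWith ℤ._+_ (Vec.map (c ℤ.*_) u) (Vec.map (ℤ.- e ℤ.*_) (v zero))
      cancel : ∀ e x → e ℤ.* x ℤ.+ ℤ.- e ℤ.* x ≡ 0ℤ
      cancel = solve-∀
      Az≡0 : Ker A z
      Az≡0 j = begin
        (A · z) j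
          ≡⟨ ·-zipWith-+ A (Vec.map (c ℤ.*_) u) (Vec.map (ℤ.- e ℤ.*_) (v zero)) j ⟩
        (A · Vec.map (c ℤ.*_) u) j ℤ.+ (A · Vec.map (ℤ.- e ℤ.*_) (v zero)) j
          ≡⟨ ≡.cong₂ ℤ._+_ (·-map-* A c u j) (·-map-* A (ℤ.- e) (v zero) j) ⟩
        c ℤ.* (A · u) j ℤ.+ ℤ.- e ℤ.* (A · v zero) j
          ≡⟨ ≡.cong (λ t → t ℤ.+ ℤ.- e ℤ.* (A · v zero) j) (cAu≡ew j) ⟩
        e ℤ.* (A · v zero) j ℤ.+ ℤ.- e ℤ.* (A · v zero) j
          ≡⟨ cancel e ((A · v zero) j) ⟩
        0ℤ ∎
      lift : Sat (Span k (v ∘ suc)) z → Sat (Span (ℕ.suc k) v) u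
      lift (c′ , c′≢0 , c′z∈L) =
        c′ ℤ.* c , *-≢0 c′≢0 c≢0 ,
        ≡.subst (Span (ℕ.suc k) v) (≡.sym (rescale c′ c e u (v zero))) (Span-suc v (c′ ℤ.* e) c′z∈L)

    Sat-Span-suc⇔ : ∀ u → Sat (Span (ℕ.suc k) v) u ⇔ Proportional (A · u) (A · v zero)
    Sat-Span-suc⇔ u = mk⇔ (Sat-Span-suc⇒Proportional u) (Proportional⇒Sat-Span-suc u)

  Proportional-to-zero⇔ : ∀ {m} {x w : Fin m → ℤ} → (∀ j → w j ≡ 0ℤ) →
                          Proportional x w ⇔ (∀ j → x j ≡ 0ℤ)
  Proportional-to-zero⇔ {x = x} {w} w≡0 = mk⇔ to from
    where
    to : Proportional x w → ∀ j → x j ≡ 0ℤ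
    to (c , e , c≢0 , cx≡ew) j = *-cancelˡ-≢0 c≢0 (begin
      c ℤ.* x j  ≡⟨ cx≡ew j ⟩
      e ℤ.* w j  ≡⟨ ≡.cong (e ℤ.*_) (w≡0 j) ⟩
      e ℤ.* 0ℤ   ≡⟨ ℤP.*-zeroʳ e ⟩
      0ℤ         ≡⟨ ℤP.*-zeroʳ c ⟨
      c ℤ.* 0ℤ   ∎)
    from : (∀ j → x j ≡ 0ℤ) → Proportional x w
    from x≡0 = 1ℤ , 0ℤ , (λ ()) , λ j →
      ≡.trans (ℤP.*-identityˡ (x j)) (≡.trans (x≡0 j) (≡.sym (ℤP.*-zeroˡ (w j))))

  Proportional⇔minors : ∀ {m} {x w : Fin m → ℤ} j₀ → w j₀ ≢ 0ℤ →
                        Proportional x w ⇔ (∀ j → x j ℤ.* w j₀ ≡ x j₀ ℤ.* w j)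
  Proportional⇔minors {x = x} {w} j₀ wj₀≢0 = mk⇔ to from
    where
    to : Proportional x w → ∀ j → x j ℤ.* w j₀ ≡ x j₀ ℤ.* w j
    to (c , e , c≢0 , cx≡ew) j = *-cancelˡ-≢0 c≢0 (begin
      c ℤ.* (x j ℤ.* w j₀)    ≡⟨ ℤP.*-assoc c (x j) (w j₀) ⟨
      (c ℤ.* x j) ℤ.* w j₀    ≡⟨ ≡.cong (ℤ._* w j₀) (cx≡ew j) ⟩
      (e ℤ.* w j) ℤ.* w j₀    ≡⟨ xy∙z≈xz∙y e (w j) (w j₀) ⟩
      (e ℤ.* w j₀) ℤ.* w j    ≡⟨ ≡.cong (ℤ._* w j) (cx≡ew j₀) ⟨
      (c ℤ.* x j₀) ℤ.* w j    ≡⟨ ℤP.*-assoc c (x j₀) (w j) ⟩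
      c ℤ.* (x j₀ ℤ.* w j)    ∎)
    from : (∀ j → x j ℤ.* w j₀ ≡ x j₀ ℤ.* w j) → Proportional x w
    from minors = w j₀ , x j₀ , wj₀≢0 , λ j → ≡.trans (ℤP.*-comm (w j₀) (x j)) (minors j)

  minorMatrix : ∀ {m d} → Mat m d → (Fin m → ℤ) → Fin m → Mat m d
  minorMatrix A w j₀ j i = A j i ℤ.* w j₀ ℤ.- A j₀ i ℤ.* w j

  ·-minorMatrix : ∀ {m d} (A : Mat m d) w j₀ u j →
                  (minorMatrix A w j₀ · u) j ≡ (A · u) j ℤ.* w j₀ ℤ.- (A · u) j₀ ℤ.* w j
  ·-minorMatrix A w j₀ u j = begin
    (minorMatrix A w j₀ · u) j
      ≡⟨ sum-cong-≋ (λ i → expand (A j i) (w j₀) (A j₀ i) (w j) (lookup u i)) ⟩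
    sum (λ i → f i ℤ.* w j₀ ℤ.+ g i ℤ.* ℤ.- w j)
      ≡⟨ ∑-distrib-+ (λ i → f i ℤ.* w j₀) (λ i → g i ℤ.* ℤ.- w j) ⟩
    sum (λ i → f i ℤ.* w j₀) ℤ.+ sum (λ i → g i ℤ.* ℤ.- w j)
      ≡⟨ ≡.cong₂ ℤ._+_ (*-distribʳ-sum (w j₀) f) (*-distribʳ-sum (ℤ.- w j) g) ⟨
    sum f ℤ.* w j₀ ℤ.+ sum g ℤ.* ℤ.- w j
      ≡⟨ ≡.cong (λ t → sum f ℤ.* w j₀ ℤ.+ t) (ℤP.neg-distribʳ-* (sum g) (w j)) ⟨
    sum f ℤ.* w j₀ ℤ.- sum g ℤ.* w j ∎
    where
    f g : Fin _ → ℤ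
    f i = A j i ℤ.* lookup u i
    g i = A j₀ i ℤ.* lookup u i
    expand : ∀ a w₀ b wⱼ x → (a ℤ.* w₀ ℤ.- b ℤ.* wⱼ) ℤ.* x ≡ (a ℤ.* x) ℤ.* w₀ ℤ.+ (b ℤ.* x) ℤ.* ℤ.- wⱼ
    expand = solve-∀

  Ker-minorMatrix⇔ : ∀ {m d} (A : Mat m d) w j₀ u →
                     Ker (minorMatrix A w j₀) u ⇔ (∀ j → (A · u) j ℤ.* w j₀ ≡ (A · u) j₀ ℤ.* w j)
  Ker-minorMatrix⇔ A w j₀ u =
    mk⇔ (λ ker j → ℤP.i-j≡0⇒i≡j _ _ (≡.trans (≡.sym (·-minorMatrix A w j₀ u j)) (ker j)))
        (λ minors j → ≡.trans (·-minorMatrix A w j₀ u j) (ℤP.i≡j⇒i-j≡0 (minors j)))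

  saturation-kernel : ∀ {d} k (v : Fin k → ZVec d) →
                      Σ ℕ λ m → Σ (Mat m d) λ A → ∀ u → Ker A u ⇔ Sat (Span k v) u
  saturation-kernel {d} ℕ.zero v =
    d , identity , λ u → ⇔-trans (Ker-identity⇔ u) (⇔-sym (Sat-Span-zero⇔ v u))
  saturation-kernel (ℕ.suc k) v with saturation-kernel k (v ∘ suc)
  ... | m , A , ker⇔ with FinP.all? (λ j → (A · v zero) j ℤ.≟ 0ℤ)
  ...   | yes w≡0 = m , A , λ u →
          ⇔-sym (⇔-trans (Sat-Span-suc⇔ v A ker⇔ u) (Proportional-to-zero⇔ w≡0))
  ...   | no w≢0 with FinP.¬∀⟶∃¬ m _ (λ j → (A · v zero) j ℤ.≟ 0ℤ) w≢0
  ...     | j₀ , wj₀≢0 = m , minorMatrix A (A · v zero) j₀ , λ u →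
            ⇔-trans (Ker-minorMatrix⇔ A (A · v zero) j₀ u)
                    (⇔-sym (⇔-trans (Sat-Span-suc⇔ v A ker⇔ u) (Proportional⇔minors j₀ wj₀≢0)))

module MultiplicativeIndependence where
  open import Data.Nat using (_≤_; z≤n; s≤s)
  open import Data.Nat.Coprimality as Coprimality using (Coprime; coprime-divisor)
  open import Data.Nat.Divisibility
    using (_∣_; ∣-refl; ∣-trans; ∣1⇒≡1; ∣m+n∣m⇒∣n; m∣m*n; n∣m*n)
  open Products ℕP.+-*-commutativeSemiring
  open ≡.≡-Reasoning

  ≥2⇒nonZero : ∀ {q} → 2 ≤ q → ℕ.NonZero q
  ≥2⇒nonZero (s≤s (s≤s _)) = _

  ^-nonZero : ∀ x n → .{{ℕ.NonZero x}} → ℕ.NonZero (x ^ n)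
  ^-nonZero x ℕ.zero    = _
  ^-nonZero x (ℕ.suc n) = ℕP.m*n≢0 x (x ^ n)
    where instance _ = ^-nonZero x n

  coprime-*ʳ : ∀ {q a b} → Coprime q a → Coprime q b → Coprime q (a ℕ.* b)
  coprime-*ʳ q⊥a q⊥b (i∣q , i∣ab) =
    q⊥b (i∣q , coprime-divisor (λ (k∣i , k∣a) → q⊥a (∣-trans k∣i i∣q , k∣a)) i∣ab)

  coprime-^ʳ : ∀ {q a} n → Coprime q a → Coprime q (a ^ n)
  coprime-^ʳ ℕ.zero    q⊥a = ∣1⇒≡1 ∘ proj₂
  coprime-^ʳ (ℕ.suc n) q⊥a = coprime-*ʳ q⊥a (coprime-^ʳ n q⊥a)

  coprime-∏ʳ : ∀ {q n} (f : Fin n → ℕ) → (∀ i → Coprime q (f i)) → Coprime q (∏ f)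
  coprime-∏ʳ {n = ℕ.zero}  f q⊥f = ∣1⇒≡1 ∘ proj₂
  coprime-∏ʳ {n = ℕ.suc n} f q⊥f = coprime-*ʳ (q⊥f zero) (coprime-∏ʳ (f ∘ suc) (q⊥f ∘ suc))

  coprime-1+multiple : ∀ {q x} → q ∣ x → Coprime q (ℕ.suc x)
  coprime-1+multiple {x = x} q∣x {i} (i∣q , i∣1+x) =
    ∣1⇒≡1 (∣m+n∣m⇒∣n (≡.subst (i ∣_) (ℕP.+-comm 1 x) i∣1+x) (∣-trans i∣q q∣x))

  coprime⇒∤ : ∀ {q a} → 2 ≤ q → Coprime q a → ¬ q ∣ a
  coprime⇒∤ q≥2 q⊥a q∣a = ℕP.<⇒≢ q≥2 (≡.sym (q⊥a (∣-refl , q∣a)))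

  ^-*-cancel : ∀ {q A B} → 2 ≤ q → Coprime q A → Coprime q B →
               ∀ a b → q ^ a ℕ.* A ≡ q ^ b ℕ.* B → a ≡ b
  ^-*-cancel q≥2 q⊥A q⊥B ℕ.zero    ℕ.zero    eq = ≡.refl
  ^-*-cancel {q} {A} {B} q≥2 q⊥A q⊥B ℕ.zero (ℕ.suc b) eq = ⊥-elim (coprime⇒∤ q≥2 q⊥A q∣A)
    where
    q∣A : q ∣ A
    q∣A = ≡.subst (q ∣_) (≡.sym (≡.trans (≡.sym (ℕP.*-identityˡ A)) (≡.trans eq (ℕP.*-assoc q (q ^ b) B))))
                  (m∣m*n (q ^ b ℕ.* B))
  ^-*-cancel q≥2 q⊥A q⊥B (ℕ.suc a) ℕ.zero    eq =
    ≡.sym (^-*-cancel q≥2 q⊥B q⊥A ℕ.zero (ℕ.suc a) (≡.sym eq))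
  ^-*-cancel {q} {A} {B} q≥2 q⊥A q⊥B (ℕ.suc a) (ℕ.suc b) eq =
    ≡.cong ℕ.suc (^-*-cancel q≥2 q⊥A q⊥B a b (ℕP.*-cancelˡ-≡ _ _ q (begin
      q ℕ.* (q ^ a ℕ.* A) ≡⟨ ℕP.*-assoc q (q ^ a) A ⟨
      q ^ ℕ.suc a ℕ.* A   ≡⟨ eq ⟩
      q ^ ℕ.suc b ℕ.* B   ≡⟨ ℕP.*-assoc q (q ^ b) B ⟩
      q ℕ.* (q ^ b ℕ.* B) ∎)))
    where instance _ = ≥2⇒nonZero q≥2

  PairwiseCoprime : ∀ {m} → (Fin m → ℕ) → Set
  PairwiseCoprime p = ∀ i j → i ≢ j → Coprime (p i) (p j)

  ∏^-injective : ∀ {m} (p : Fin m → ℕ) → (∀ j → 2 ≤ p j) → PairwiseCoprime p →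
                 (e f : Fin m → ℕ) → ∏ (λ j → p j ^ e j) ≡ ∏ (λ j → p j ^ f j) →
                 ∀ j → e j ≡ f j
  ∏^-injective {ℕ.zero}  p p≥2 coprime e f eq ()
  ∏^-injective {ℕ.suc m} p p≥2 coprime e f eq = heads-and-tails
    where
    rest : (Fin (ℕ.suc m) → ℕ) → ℕ
    rest g = ∏ (λ j → p (suc j) ^ g (suc j))
    p₀⊥rest : ∀ g → Coprime (p zero) (rest g)
    p₀⊥rest g = coprime-∏ʳ _ (λ j → coprime-^ʳ (g (suc j)) (coprime zero (suc j) (λ ())))
    head≡ : e zero ≡ f zero
    head≡ = ^-*-cancel (p≥2 zero) (p₀⊥rest e) (p₀⊥rest f) (e zero) (f zero) eq
    instance
      _ = ^-nonZero (p zero) (e zero) {{≥2⇒nonZero (p≥2 zero)}}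
    tail≡ : rest e ≡ rest f
    tail≡ = ℕP.*-cancelˡ-≡ (rest e) (rest f) (p zero ^ e zero)
              (≡.trans eq (≡.cong (λ k → p zero ^ k ℕ.* rest f) (≡.sym head≡)))
    heads-and-tails : ∀ j → e j ≡ f j
    heads-and-tails zero    = head≡
    heads-and-tails (suc j) =
      ∏^-injective (p ∘ suc) (p≥2 ∘ suc) (λ i k i≢k → coprime (suc i) (suc k) (i≢k ∘ FinP.suc-injective))
                   (e ∘ suc) (f ∘ suc) tail≡ j

  ∏^-nonZero : ∀ {m} (p : Fin m → ℕ) → (∀ j → 2 ≤ p j) → (e : Fin m → ℕ) → ℕ.NonZero (∏ (λ j → p j ^ e j))
  ∏^-nonZero {ℕ.zero}  p p≥2 e = _
  ∏^-nonZero {ℕ.suc m} p p≥2 e = ℕP.m*n≢0 (p zero ^ e zero) _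
    where instance
      _ = ^-nonZero (p zero) (e zero) {{≥2⇒nonZero (p≥2 zero)}}
      _ = ∏^-nonZero (p ∘ suc) (p≥2 ∘ suc) (e ∘ suc)

  sylvester : ∀ m → ℕ → Fin m → ℕ
  sylvester (ℕ.suc m) P zero    = ℕ.suc P
  sylvester (ℕ.suc m) P (suc i) = sylvester m (P ℕ.* ℕ.suc P) i

  sylvester-1+multiple : ∀ m P i → ∃ λ x → sylvester m P i ≡ ℕ.suc x × P ∣ x
  sylvester-1+multiple (ℕ.suc m) P zero    = P , ≡.refl , ∣-refl
  sylvester-1+multiple (ℕ.suc m) P (suc i) with sylvester-1+multiple m (P ℕ.* ℕ.suc P) i
  ... | x , s≡1+x , P′∣x = x , s≡1+x , ∣-trans (m∣m*n (ℕ.suc P)) P′∣x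

  sylvester-≥2 : ∀ m P → 1 ≤ P → ∀ i → 2 ≤ sylvester m P i
  sylvester-≥2 (ℕ.suc m) P P≥1 zero    = s≤s P≥1
  sylvester-≥2 (ℕ.suc m) P P≥1 (suc i) = sylvester-≥2 m _ (ℕP.*-mono-≤ P≥1 (s≤s z≤n)) i

  sylvester-head-coprime : ∀ m P j → Coprime (ℕ.suc P) (sylvester m (P ℕ.* ℕ.suc P) j)
  sylvester-head-coprime m P j with sylvester-1+multiple m (P ℕ.* ℕ.suc P) j
  ... | x , s≡1+x , P′∣x =
    ≡.subst (Coprime (ℕ.suc P)) (≡.sym s≡1+x) (coprime-1+multiple (∣-trans (n∣m*n P) P′∣x))

  sylvester-coprime : ∀ m P → PairwiseCoprime (sylvester m P)
  sylvester-coprime (ℕ.suc m) P zero    zero    0≢0 = ⊥-elim (0≢0 ≡.refl)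
  sylvester-coprime (ℕ.suc m) P zero    (suc j) _   = sylvester-head-coprime m P j
  sylvester-coprime (ℕ.suc m) P (suc i) zero    _   = Coprimality.sym (sylvester-head-coprime m P i)
  sylvester-coprime (ℕ.suc m) P (suc i) (suc j) i≢j = sylvester-coprime m _ i j (i≢j ∘ ≡.cong suc)

module RationalEigenvalues where
  open import Data.Nat using (_≤_; z≤n; s≤s)
  open IntegerMatrices
  open MultiplicativeIndependence
  open ≡.≡-Reasoning

  private
    ℚ-ring = ℚP.+-*-commutativeRing
    module ℕΠ = Products ℕP.+-*-commutativeSemiring
    module ℚΠ = Products (CommutativeRing.commutativeSemiring ℚ-ring)
    open import Algebra.Properties.Semiring.Mult (CommutativeRing.semiring ℚ-ring)
      using (×-homo-1; ×1-homo-*) renaming (_×_ to _×ℚ_)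
    open import Algebra.Properties.Quasigroup
      (Algebra.Properties.Group.quasigroup (CommutativeRing.+-group ℚ-ring)) using (cancelˡ)
    open import Algebra.Properties.CommutativeSemigroup (CommutativeRing.*-commutativeSemigroup ℚ-ring)
      using (xy∙z≈xz∙y)

  ℕ→ℚ : ℕ → ℚ
  ℕ→ℚ n = n ×ℚ 1ℚ

  ℕ→ℚ-pos : ∀ n → ℚ.Positive (ℕ→ℚ (ℕ.suc n))
  ℕ→ℚ-pos n = ℚP.pos+nonNeg⇒pos 1ℚ (ℕ→ℚ n) {{nonNeg n}}
    where
    nonNeg : ∀ n → ℚ.NonNegative (ℕ→ℚ n)
    nonNeg ℕ.zero    = _
    nonNeg (ℕ.suc n) = ℚP.nonNeg+nonNeg⇒nonNeg 1ℚ (ℕ→ℚ n) {{nonNeg n}}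

  ℕ→ℚ-nonZero : ∀ n → .{{ℕ.NonZero n}} → ℚ.NonZero (ℕ→ℚ n)
  ℕ→ℚ-nonZero (ℕ.suc n) = ℚP.pos⇒nonZero (ℕ→ℚ (ℕ.suc n)) {{ℕ→ℚ-pos n}}

  ℕ→ℚ-injective : ∀ {m n} → ℕ→ℚ m ≡ ℕ→ℚ n → m ≡ n
  ℕ→ℚ-injective {ℕ.zero}  {ℕ.zero}  eq = ≡.refl
  ℕ→ℚ-injective {ℕ.zero}  {ℕ.suc n} eq = ⊥-elim (ℚP.<⇒≢ (ℚP.positive⁻¹ _ {{ℕ→ℚ-pos n}}) eq)
  ℕ→ℚ-injective {ℕ.suc m} {ℕ.zero}  eq =
    ⊥-elim (ℚP.<⇒≢ (ℚP.positive⁻¹ _ {{ℕ→ℚ-pos m}}) (≡.sym eq))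
  ℕ→ℚ-injective {ℕ.suc m} {ℕ.suc n} eq = ≡.cong ℕ.suc (ℕ→ℚ-injective (cancelˡ 1ℚ _ _ eq))

  ℕ→ℚ-*-≡⇔ : ∀ a b c d → (ℕ→ℚ a ℚ.* ℕ→ℚ b ≡ ℕ→ℚ c ℚ.* ℕ→ℚ d) ⇔ (a ℕ.* b ≡ c ℕ.* d)
  ℕ→ℚ-*-≡⇔ a b c d =
    mk⇔ (λ eq → ℕ→ℚ-injective (≡.trans (×1-homo-* a b) (≡.trans eq (≡.sym (×1-homo-* c d)))))
        (λ eq → ≡.trans (≡.sym (×1-homo-* a b)) (≡.trans (≡.cong ℕ→ℚ eq) (×1-homo-* c d)))

  open ProductHomomorphism ℕP.+-*-commutativeSemiring (CommutativeRing.commutativeSemiring ℚ-ring)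
    ℕ→ℚ (×-homo-1 1ℚ) ×1-homo-* using () renaming (h-monomial to ℕ→ℚ-monomial)

  *-cancelʳ-nonZero : ∀ {a b} c .{{_ : ℚ.NonZero c}} → a ℚ.* c ≡ b ℚ.* c → a ≡ b
  *-cancelʳ-nonZero {a} {b} c ac≡bc = begin
    a                      ≡⟨ ℚP.*-identityʳ a ⟨
    a ℚ.* 1ℚ               ≡⟨ ≡.cong (a ℚ.*_) (ℚP.*-inverseʳ c) ⟨
    a ℚ.* (c ℚ.* ℚ.1/ c)   ≡⟨ ℚP.*-assoc a c _ ⟨
    (a ℚ.* c) ℚ.* ℚ.1/ c   ≡⟨ ≡.cong (ℚ._* ℚ.1/ c) ac≡bc ⟩
    (b ℚ.* c) ℚ.* ℚ.1/ c   ≡⟨ ℚP.*-assoc b c _ ⟩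
    b ℚ.* (c ℚ.* ℚ.1/ c)   ≡⟨ ≡.cong (b ℚ.*_) (ℚP.*-inverseʳ c) ⟩
    b ℚ.* 1ℚ               ≡⟨ ℚP.*-identityʳ b ⟩
    b                      ∎

  quotient-≡⇔ : ∀ {x y a b c d} .{{_ : ℚ.NonZero c}} .{{_ : ℚ.NonZero d}} →
                x ℚ.* c ≡ a → y ℚ.* d ≡ b → (x ≡ y ⇔ a ℚ.* d ≡ b ℚ.* c)
  quotient-≡⇔ {x} {y} {a} {b} {c} {d} xc≡a yd≡b = mk⇔ to from
    where
    to : x ≡ y → a ℚ.* d ≡ b ℚ.* c
    to ≡.refl = begin
      a ℚ.* d           ≡⟨ ≡.cong (ℚ._* d) xc≡a ⟨
      (x ℚ.* c) ℚ.* d   ≡⟨ xy∙z≈xz∙y x c d ⟩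
      (x ℚ.* d) ℚ.* c   ≡⟨ ≡.cong (ℚ._* c) yd≡b ⟩
      b ℚ.* c           ∎
    from : a ℚ.* d ≡ b ℚ.* c → x ≡ y
    from ad≡bc = *-cancelʳ-nonZero c (*-cancelʳ-nonZero d (begin
      (x ℚ.* c) ℚ.* d   ≡⟨ ≡.cong (ℚ._* d) xc≡a ⟩
      a ℚ.* d           ≡⟨ ad≡bc ⟩
      b ℚ.* c           ≡⟨ ≡.cong (ℚ._* c) yd≡b ⟨
      (y ℚ.* d) ℚ.* c   ≡⟨ xy∙z≈xz∙y y d c ⟩
      (y ℚ.* c) ℚ.* d   ∎))

  module Eigenvalues {m d} (A : Mat m d) where
    open ℕΠ using (_^_; ∏)

    p : Fin m → ℕ
    p = sylvester m 1

    p≥2 : ∀ j → 2 ≤ p j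
    p≥2 = sylvester-≥2 m 1 (s≤s z≤n)

    χ : (Fin m → ℕ) → ℕ
    χ e = ∏ (λ j → p j ^ e j)

    ℕ→ℚ-χ≢0 : ∀ e → ℚ.NonZero (ℕ→ℚ (χ e))
    ℕ→ℚ-χ≢0 e = ℕ→ℚ-nonZero (χ e) {{∏^-nonZero p p≥2 e}}

    χ-+ : ∀ e f → χ (λ j → e j ℕ.+ f j) ≡ χ e ℕ.* χ f
    χ-+ e f = ≡.trans (ℕΠ.∏-cong (λ j → ℕΠ.^-homo-* (p j) (e j) (f j)))
                      (ℕΠ.∏-distrib-* (λ j → p j ^ e j) (λ j → p j ^ f j))

    χ-*-≡⇔ : ∀ e f g h → (χ e ℕ.* χ f ≡ χ g ℕ.* χ h) ⇔ (∀ j → e j ℕ.+ f j ≡ g j ℕ.+ h j)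
    χ-*-≡⇔ e f g h = mk⇔
      (λ eq → ∏^-injective p p≥2 (sylvester-coprime m 1) _ _
                (≡.trans (χ-+ e f) (≡.trans eq (≡.sym (χ-+ g h)))))
      (λ eq → ≡.trans (≡.sym (χ-+ e f))
                (≡.trans (ℕΠ.∏-cong (λ j → ≡.cong (p j ^_) (eq j))) (χ-+ g h)))

    monomial-χ : ∀ (E : Fin m → Fin d → ℕ) α → ℕΠ.monomial (λ i → χ (λ j → E j i)) α ≡ χ (E ⊙ α)
    monomial-χ E α = begin
      ∏ (λ i → ∏ (λ j → p j ^ E j i) ^ lookup α i)
        ≡⟨ ℕΠ.∏-cong (λ i → ℕΠ.∏-^ (λ j → p j ^ E j i) (lookup α i)) ⟨
      ∏ (λ i → ∏ (λ j → (p j ^ E j i) ^ lookup α i))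
        ≡⟨ ℕΠ.∏-cong (λ i → ℕΠ.∏-cong (λ j → ℕΠ.^-assocʳ (p j) (E j i) (lookup α i))) ⟩
      ∏ (λ i → ∏ (λ j → p j ^ (E j i ℕ.* lookup α i)))
        ≡⟨ ℕΠ.∏-comm (λ i j → p j ^ (E j i ℕ.* lookup α i)) ⟩
      ∏ (λ j → ∏ (λ i → p j ^ (E j i ℕ.* lookup α i)))
        ≡⟨ ℕΠ.∏-cong (λ j → ℕΠ.^-∑ℕ (p j) (λ i → E j i ℕ.* lookup α i)) ⟨
      χ (E ⊙ α) ∎

    A⁺ A⁻ : Fin m → Fin d → ℕ
    A⁺ = pos ∘₂ A
    A⁻ = neg ∘₂ A

    numerator denominator : Fin d → ℕ
    numerator   i = χ (λ j → A⁺ j i)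
    denominator i = χ (λ j → A⁻ j i)

    eigenvalue : Fin d → ℚ
    eigenvalue i = ℕ→ℚ (numerator i) ℚ.* ℚ.1/ ℕ→ℚ (denominator i)
      where instance _ = ℕ→ℚ-χ≢0 (λ j → A⁻ j i)

    eigenvalue-* : ∀ i → eigenvalue i ℚ.* ℕ→ℚ (denominator i) ≡ ℕ→ℚ (numerator i)
    eigenvalue-* i = begin
      (N ℚ.* ℚ.1/ D) ℚ.* D    ≡⟨ ℚP.*-assoc N (ℚ.1/ D) D ⟩
      N ℚ.* (ℚ.1/ D ℚ.* D)    ≡⟨ ≡.cong (N ℚ.*_) (ℚP.*-inverseˡ D) ⟩
      N ℚ.* 1ℚ                ≡⟨ ℚP.*-identityʳ N ⟩
      N                       ∎
      where
      N = ℕ→ℚ (numerator i)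
      D = ℕ→ℚ (denominator i)
      instance _ = ℕ→ℚ-χ≢0 (λ j → A⁻ j i)

    monomial-eigenvalue-* : ∀ α → ℚΠ.monomial eigenvalue α ℚ.* ℕ→ℚ (χ (A⁻ ⊙ α)) ≡ ℕ→ℚ (χ (A⁺ ⊙ α))
    monomial-eigenvalue-* α = begin
      ℚΠ.monomial eigenvalue α ℚ.* ℕ→ℚ (χ (A⁻ ⊙ α))
        ≡⟨ ≡.cong (ℚΠ.monomial eigenvalue α ℚ.*_)
             (≡.trans (≡.cong ℕ→ℚ (≡.sym (monomial-χ A⁻ α))) (ℕ→ℚ-monomial denominator α)) ⟩
      ℚΠ.monomial eigenvalue α ℚ.* ℚΠ.monomial (ℕ→ℚ ∘ denominator) α
        ≡⟨ ℚΠ.∏-distrib-* (λ i → eigenvalue i ℚΠ.^ lookup α i) (λ i → ℕ→ℚ (denominator i) ℚΠ.^ lookup α i) ⟨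
      ℚΠ.∏ (λ i → eigenvalue i ℚΠ.^ lookup α i ℚ.* ℕ→ℚ (denominator i) ℚΠ.^ lookup α i)
        ≡⟨ ℚΠ.∏-cong (λ i → ≡.trans (≡.sym (ℚΠ.^-distrib-* _ _ (lookup α i)))
                                    (≡.cong (ℚΠ._^ lookup α i) (eigenvalue-* i))) ⟩
      ℚΠ.monomial (ℕ→ℚ ∘ numerator) α
        ≡⟨ ≡.trans (≡.cong ℕ→ℚ (≡.sym (monomial-χ A⁺ α))) (ℕ→ℚ-monomial numerator α) ⟨
      ℕ→ℚ (χ (A⁺ ⊙ α)) ∎

    balanced⇔·-≡ : ∀ α β → (∀ j → (A⁺ ⊙ α) j ℕ.+ (A⁻ ⊙ β) j ≡ (A⁺ ⊙ β) j ℕ.+ (A⁻ ⊙ α) j)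
                          ⇔ (∀ j → (A · toZVec α) j ≡ (A · toZVec β) j)
    balanced⇔·-≡ α β = mk⇔
      (λ eq j → ≡.trans (·-toZVec A α j)
                  (≡.trans (Equivalence.to (differences j) (eq j)) (≡.sym (·-toZVec A β j))))
      (λ eq j → Equivalence.from (differences j)
                  (≡.trans (≡.sym (·-toZVec A α j)) (≡.trans (eq j) (·-toZVec A β j))))
      where
      differences = λ j → ℕ-differences-≡⇔ ((A⁺ ⊙ α) j) ((A⁻ ⊙ α) j) ((A⁺ ⊙ β) j) ((A⁻ ⊙ β) j)

    monomial-eigenvalue-≡⇔ : ∀ α β → ℚΠ.monomial eigenvalue α ≡ ℚΠ.monomial eigenvalue β
                                     ⇔ (∀ j → (A · toZVec α) j ≡ (A · toZVec β) j)
    monomial-eigenvalue-≡⇔ α β =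
      ⇔-trans (quotient-≡⇔ {{ℕ→ℚ-χ≢0 (A⁻ ⊙ α)}} {{ℕ→ℚ-χ≢0 (A⁻ ⊙ β)}}
                           (monomial-eigenvalue-* α) (monomial-eigenvalue-* β))
      (⇔-trans (ℕ→ℚ-*-≡⇔ (χ (A⁺ ⊙ α)) (χ (A⁻ ⊙ β)) (χ (A⁺ ⊙ β)) (χ (A⁻ ⊙ α)))
      (⇔-trans (χ-*-≡⇔ (A⁺ ⊙ α) (A⁻ ⊙ β) (A⁺ ⊙ β) (A⁻ ⊙ α))
               (balanced⇔·-≡ α β)))

-- Evaluation, coefficients and class sums of a polynomial are all instances of weigh.
module Weighing {c ℓ} (K : CommutativeRing c ℓ) (d : ℕ) where
  open CommutativeRing K hiding (zero)
  open Poly K d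
  open import Relation.Binary.Reasoning.Setoid setoid
  open import Algebra.Properties.Ring ring using (-‿distribˡ-*; -1*x≈-x)
  open import Algebra.Properties.AbelianGroup +-abelianGroup using (⁻¹-∙-comm)
  open import Algebra.Properties.Group +-group using (ε⁻¹≈ε; x∙y⁻¹≈ε⇒x≈y; x≈y⇒x∙y⁻¹≈ε)
  open import Algebra.Properties.CommutativeSemigroup +-commutativeSemigroup
    using () renaming (interchange to +-interchange; x∙yz≈y∙xz to x+[y+z]≈y+[x+z])
  open import Algebra.Properties.CommutativeSemigroup *-commutativeSemigroup
    using () renaming (interchange to *-interchange; x∙yz≈y∙xz to x*[y*z]≈y*[x*z])

  weigh : (Exp d → Carrier) → Poly → Carrier
  weigh g []            = 0#
  weigh g ((a , α) ∷ P) = a * g α + weigh g P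

  weigh-cong-on : ∀ {g h} P → All (λ t → g (proj₂ t) ≈ h (proj₂ t)) P → weigh g P ≈ weigh h P
  weigh-cong-on []            []           = refl
  weigh-cong-on ((a , α) ∷ P) (g≈h ∷ rest) = +-cong (*-congˡ g≈h) (weigh-cong-on P rest)

  weigh-cong : ∀ {g h} → (∀ α → g α ≈ h α) → ∀ P → weigh g P ≈ weigh h P
  weigh-cong g≈h P = weigh-cong-on P (All.universal (g≈h ∘ proj₂) P)

  weigh-+ : ∀ g h P → weigh (λ α → g α + h α) P ≈ weigh g P + weigh h P
  weigh-+ g h []            = sym (+-identityʳ 0#)
  weigh-+ g h ((a , α) ∷ P) =
    trans (+-cong (distribˡ a (g α) (h α)) (weigh-+ g h P)) (+-interchange _ _ _ _)

  weigh-*ˡ : ∀ k g P → weigh (λ α → k * g α) P ≈ k * weigh g P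
  weigh-*ˡ k g []            = sym (zeroʳ k)
  weigh-*ˡ k g ((a , α) ∷ P) =
    trans (+-cong (x*[y*z]≈y*[x*z] a k (g α)) (weigh-*ˡ k g P)) (sym (distribˡ k _ _))

  weigh-- : ∀ g h P → weigh (λ α → g α - h α) P ≈ weigh g P - weigh h P
  weigh-- g h P = begin
    weigh (λ α → g α - h α) P                 ≈⟨ weigh-+ g (λ α → - h α) P ⟩
    weigh g P + weigh (λ α → - h α) P         ≈⟨ +-congˡ (weigh-cong (λ α → -1*x≈-x (h α)) P) ⟨
    weigh g P + weigh (λ α → - 1# * h α) P    ≈⟨ +-congˡ (trans (weigh-*ˡ (- 1#) h P) (-1*x≈-x _)) ⟩
    weigh g P - weigh h P                     ∎

  weigh-++ : ∀ g P Q → weigh g (P ++ Q) ≈ weigh g P + weigh g Q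
  weigh-++ g []            Q = sym (+-identityˡ _)
  weigh-++ g ((a , α) ∷ P) Q = trans (+-congˡ (weigh-++ g P Q)) (sym (+-assoc _ _ _))

  weigh-neg : ∀ g P → weigh g (-P P) ≈ - weigh g P
  weigh-neg g []            = sym ε⁻¹≈ε
  weigh-neg g ((a , α) ∷ P) =
    trans (+-cong (sym (-‿distribˡ-* a (g α))) (weigh-neg g P)) (⁻¹-∙-comm _ _)

  weigh-binom : ∀ g α β → weigh g (binom α β) ≈ g α - g β
  weigh-binom g α β = +-cong (*-identityˡ (g α)) (trans (+-identityʳ _) (-1*x≈-x (g β)))

  Multiplicative : (Exp d → Carrier) → Set ℓ
  Multiplicative g = ∀ α β → g (Vec.zipWith ℕ._+_ α β) ≈ g α * g β

  weigh-*P : ∀ {g} → Multiplicative g → ∀ P Q → weigh g (P *P Q) ≈ weigh g P * weigh g Q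
  weigh-*P     g-mul []            Q = sym (zeroˡ _)
  weigh-*P {g} g-mul ((a , α) ∷ P) Q = begin
    weigh g (shift Q ++ (P *P Q))                  ≈⟨ weigh-++ g (shift Q) (P *P Q) ⟩
    weigh g (shift Q) + weigh g (P *P Q)           ≈⟨ +-cong (weigh-shift Q) (weigh-*P g-mul P Q) ⟩
    (a * g α) * weigh g Q + weigh g P * weigh g Q  ≈⟨ distribʳ _ _ _ ⟨
    (a * g α + weigh g P) * weigh g Q              ∎
    where
    shift : Poly → Poly
    shift = List.map (λ { (b , β) → (a * b , Vec.zipWith ℕ._+_ α β) })
    weigh-shift : ∀ Q → weigh g (shift Q) ≈ (a * g α) * weigh g Q
    weigh-shift []            = sym (zeroʳ _)
    weigh-shift ((b , β) ∷ Q) =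
      trans (+-cong (trans (*-congˡ (g-mul α β)) (*-interchange a b (g α) (g β))) (weigh-shift Q))
            (sym (distribˡ _ _ _))

  0⃗ : Exp d
  0⃗ = Vec.replicate d 0

  weigh-constant-*P : ∀ g a P → weigh g (((a , 0⃗) ∷ []) *P P) ≈ a * weigh g P
  weigh-constant-*P g a P = trans (weigh-++ g (shift P) []) (trans (+-identityʳ _) (weigh-shift P))
    where
    shift : Poly → Poly
    shift = List.map (λ { (b , β) → (a * b , Vec.zipWith ℕ._+_ 0⃗ β) })
    weigh-shift : ∀ P → weigh g (shift P) ≈ a * weigh g P
    weigh-shift []            = sym (zeroʳ a)
    weigh-shift ((b , β) ∷ P) =
      trans (+-cong (trans (*-congˡ (reflexive (≡.cong g (VecP.zipWith-identityˡ ℕP.+-identityˡ β))))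
                           (*-assoc a b (g β)))
                    (weigh-shift P))
            (sym (distribˡ a _ _))

  scale : (Exp d → Carrier) → Poly → Poly
  scale s = List.map (λ { (a , α) → (a * s α , α) })

  weigh-scale : ∀ g s P → weigh g (scale s P) ≈ weigh (λ α → s α * g α) P
  weigh-scale g s []            = refl
  weigh-scale g s ((a , α) ∷ P) = +-cong (*-assoc a (s α) (g α)) (weigh-scale g s P)

  eval≈weigh : ∀ P x → eval P x ≈ weigh (λ α → evalMono α x) P
  eval≈weigh []            x = refl
  eval≈weigh ((a , α) ∷ P) x = +-congˡ (eval≈weigh P x)

  δ : Exp d → Exp d → Carrier
  δ γ α = if does (VecP.≡-dec ℕ._≟_ α γ) then 1# else 0#

  coeff≈weigh-δ : ∀ P γ → coeff P γ ≈ weigh (δ γ) P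
  coeff≈weigh-δ []            γ = refl
  coeff≈weigh-δ ((a , β) ∷ P) γ with VecP.≡-dec ℕ._≟_ β γ
  ... | yes _ = +-cong (sym (*-identityʳ a)) (coeff≈weigh-δ P γ)
  ... | no  _ = trans (coeff≈weigh-δ P γ) (sym (trans (+-congʳ (zeroʳ a)) (+-identityˡ _)))

  Cancellable : Carrier → Set (c ⊔ ℓ)
  Cancellable x = ∀ y → x * y ≈ 0# → y ≈ 0#

  module Classes {k} {Key : Set k} (_≟_ : DecidableEquality Key) (κ : Exp d → Key) where

    inClass : Exp d → Exp d → Carrier
    inClass γ α = if does (κ α ≟ κ γ) then 1# else 0#

    classSum : Exp d → Poly → Carrier
    classSum γ = weigh (inClass γ)

    Respects : (Exp d → Carrier) → Set (k ⊔ ℓ)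
    Respects g = ∀ {α β} → κ α ≡ κ β → g α ≈ g β

    inClass-respects : ∀ γ → Respects (inClass γ)
    inClass-respects γ κα≡κβ = reflexive (≡.cong (λ x → if does (x ≟ κ γ) then 1# else 0#) κα≡κβ)

    inClass-≢ : ∀ {γ α} → κ α ≢ κ γ → inClass γ α ≈ 0#
    inClass-≢ {γ} {α} κα≢κγ with κ α ≟ κ γ
    ... | yes κα≡κγ = ⊥-elim (κα≢κγ κα≡κγ)
    ... | no  _     = refl

    inClass-absorbs : ∀ {h} → Respects h → ∀ γ α → h α * inClass γ α ≈ h γ * inClass γ α
    inClass-absorbs h-resp γ α with κ α ≟ κ γ
    ... | yes κα≡κγ = *-congʳ (h-resp κα≡κγ)
    ... | no  _     = trans (zeroʳ _) (sym (zeroʳ _))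

    dropClass : Exp d → Poly → Poly
    dropClass β = List.filter (λ t → ¬? (κ (proj₂ t) ≟ κ β))

    length-dropClass : ∀ {a} β P → length (dropClass β ((a , β) ∷ P)) ℕ.≤ length P
    length-dropClass β P with κ β ≟ κ β
    ... | yes _    = ListP.length-filter (λ t → ¬? (κ (proj₂ t) ≟ κ β)) P
    ... | no κβ≢κβ = ⊥-elim (κβ≢κβ ≡.refl)

    classSum-dropClass-self : ∀ {β γ} → κ γ ≡ κ β → ∀ P → classSum γ (dropClass β P) ≈ 0#
    classSum-dropClass-self         κγ≡κβ []            = refl
    classSum-dropClass-self {β} {γ} κγ≡κβ ((a , α) ∷ P) with κ α ≟ κ β
    ... | yes _    = classSum-dropClass-self κγ≡κβ P
    ... | no κα≢κβ =
      trans (+-cong (trans (*-congˡ (inClass-≢ λ κα≡κγ → κα≢κβ (≡.trans κα≡κγ κγ≡κβ))) (zeroʳ a))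
                    (classSum-dropClass-self κγ≡κβ P))
            (+-identityʳ 0#)

    weigh-split : ∀ {g} → Respects g → ∀ β P →
                  weigh g P ≈ g β * classSum β P + weigh g (dropClass β P)
    weigh-split {g} g-resp β [] = sym (trans (+-identityʳ _) (zeroʳ (g β)))
    weigh-split {g} g-resp β ((a , α) ∷ P) with κ α ≟ κ β
    ... | yes κα≡κβ = begin
      a * g α + weigh g P
        ≈⟨ +-cong (*-congˡ (g-resp κα≡κβ)) (weigh-split g-resp β P) ⟩
      a * g β + (g β * classSum β P + weigh g (dropClass β P))
        ≈⟨ +-assoc _ _ _ ⟨
      (a * g β + g β * classSum β P) + weigh g (dropClass β P)
        ≈⟨ +-congʳ (+-congʳ (trans (*-comm a (g β)) (*-congˡ (sym (*-identityʳ a))))) ⟩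
      (g β * (a * 1#) + g β * classSum β P) + weigh g (dropClass β P)
        ≈⟨ +-congʳ (distribˡ (g β) _ _) ⟨
      g β * (a * 1# + classSum β P) + weigh g (dropClass β P) ∎
    ... | no κα≢κβ = begin
      a * g α + weigh g P
        ≈⟨ +-congˡ (weigh-split g-resp β P) ⟩
      a * g α + (g β * classSum β P + weigh g (dropClass β P))
        ≈⟨ x+[y+z]≈y+[x+z] _ _ _ ⟩
      g β * classSum β P + (a * g α + weigh g (dropClass β P))
        ≈⟨ +-congʳ (*-congˡ (trans (+-congʳ (zeroʳ a)) (+-identityˡ _))) ⟨
      g β * (a * 0# + classSum β P) + (a * g α + weigh g (dropClass β P)) ∎

    classSums-dropClass : ∀ β P → (∀ γ → classSum γ P ≈ 0#) → ∀ γ → classSum γ (dropClass β P) ≈ 0#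
    classSums-dropClass β P sums γ = begin
      classSum γ (dropClass β P)                               ≈⟨ +-identityˡ _ ⟨
      0# + classSum γ (dropClass β P)                          ≈⟨ +-congʳ (trans (*-congˡ (sums β)) (zeroʳ _)) ⟨
      inClass γ β * classSum β P + classSum γ (dropClass β P)  ≈⟨ weigh-split (inClass-respects γ) β P ⟨
      classSum γ P                                             ≈⟨ sums γ ⟩
      0#                                                       ∎

    weigh-classSums-zero : ∀ {g} → Respects g → ∀ P → (∀ γ → classSum γ P ≈ 0#) → weigh g P ≈ 0#
    weigh-classSums-zero {g} g-resp P = go (length P) P ℕP.≤-refl
      where
      go : ∀ n P → length P ℕ.≤ n → (∀ γ → classSum γ P ≈ 0#) → weigh g P ≈ 0#
      go n         []                _              sums = refl
      go (ℕ.suc n) P@((a , β) ∷ Q) (ℕ.s≤s |Q|≤n) sums = begin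
        weigh g P                                      ≈⟨ weigh-split g-resp β P ⟩
        g β * classSum β P + weigh g (dropClass β P)   ≈⟨ +-cong (*-congˡ (sums β)) rest≈0 ⟩
        g β * 0# + 0#                                  ≈⟨ trans (+-identityʳ _) (zeroʳ (g β)) ⟩
        0#                                             ∎
        where
        rest≈0 = go n (dropClass β P) (ℕP.≤-trans (length-dropClass β Q) |Q|≤n) (classSums-dropClass β P sums)

    -- Multiplying the terms of class α by ρ α - ρ β kills the class of β and, in the
    -- power sums, turns the n-th power sum into (n + 1)-st minus ρ β times the n-th.
    module PowerSums {ρ : Exp d → Carrier} (ρ-respects : Respects ρ)
                     (ρ-separates : ∀ {α β} → κ α ≢ κ β → Cancellable (ρ α - ρ β)) where
      open Products commutativeSemiring using (_^_; ^-congˡ)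

      PowerSumsVanish : Poly → Set ℓ
      PowerSumsVanish P = ∀ n → weigh (λ α → ρ α ^ n) P ≈ 0#

      deflate : Exp d → Poly → Poly
      deflate β P = scale (λ α → ρ α - ρ β) (dropClass β P)

      length-deflate : ∀ {a} β P → length (deflate β ((a , β) ∷ P)) ℕ.≤ length P
      length-deflate {a} β P = ≡.subst (ℕ._≤ length P) (≡.sym (ListP.length-map _ (dropClass β ((a , β) ∷ P))))
                                       (length-dropClass β P)

      deflate-powerSums : ∀ β P → PowerSumsVanish P → PowerSumsVanish (deflate β P)
      deflate-powerSums β P powers m = begin
        weigh (λ α → ρ α ^ m) (deflate β P)
          ≈⟨ weigh-scale (λ α → ρ α ^ m) _ (dropClass β P) ⟩
        weigh h (dropClass β P)
          ≈⟨ h-vanishes-on-β ⟨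
        weigh h P
          ≈⟨ weigh-cong (λ α → distribʳ (ρ α ^ m) (ρ α) (- ρ β)) P ⟩
        weigh (λ α → ρ α ^ ℕ.suc m + - ρ β * ρ α ^ m) P
          ≈⟨ weigh-+ _ _ P ⟩
        weigh (λ α → ρ α ^ ℕ.suc m) P + weigh (λ α → - ρ β * ρ α ^ m) P
          ≈⟨ +-cong (powers (ℕ.suc m)) (weigh-*ˡ (- ρ β) _ P) ⟩
        0# + - ρ β * weigh (λ α → ρ α ^ m) P
          ≈⟨ +-congˡ (trans (*-congˡ (powers m)) (zeroʳ _)) ⟩
        0# + 0#
          ≈⟨ +-identityʳ 0# ⟩
        0# ∎
        where
        h : Exp d → Carrier
        h α = (ρ α - ρ β) * ρ α ^ m
        h-respects : Respects h
        h-respects e = *-cong (+-congʳ (ρ-respects e)) (^-congˡ m (ρ-respects e))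
        h-vanishes-on-β : weigh h P ≈ weigh h (dropClass β P)
        h-vanishes-on-β = begin
          weigh h P                                     ≈⟨ weigh-split h-respects β P ⟩
          h β * classSum β P + weigh h (dropClass β P)  ≈⟨ +-congʳ (trans (*-congʳ hβ≈0) (zeroˡ _)) ⟩
          0# + weigh h (dropClass β P)                  ≈⟨ +-identityˡ _ ⟩
          weigh h (dropClass β P)                       ∎
          where hβ≈0 = trans (*-congʳ (-‿inverseʳ (ρ β))) (zeroˡ _)

      classSums-of-deflate : ∀ β P → (∀ γ → classSum γ (deflate β P) ≈ 0#) →
                             ∀ γ → classSum γ (dropClass β P) ≈ 0#
      classSums-of-deflate β P deflated-sums γ with κ γ ≟ κ β
      ... | yes κγ≡κβ = classSum-dropClass-self κγ≡κβ P
      ... | no  κγ≢κβ = ρ-separates κγ≢κβ (classSum γ G) (begin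
        (ρ γ - ρ β) * classSum γ G                 ≈⟨ weigh-*ˡ (ρ γ - ρ β) (inClass γ) G ⟨
        weigh (λ α → (ρ γ - ρ β) * inClass γ α) G  ≈⟨ weigh-cong (inClass-absorbs ρ-β-respects γ) G ⟨
        weigh (λ α → (ρ α - ρ β) * inClass γ α) G  ≈⟨ weigh-scale (inClass γ) _ G ⟨
        classSum γ (deflate β P)                   ≈⟨ deflated-sums γ ⟩
        0#                                         ∎)
        where
        G = dropClass β P
        ρ-β-respects : Respects (λ α → ρ α - ρ β)
        ρ-β-respects e = +-congʳ (ρ-respects e)

      classSum-self : ∀ β P → PowerSumsVanish P → (∀ γ → classSum γ (dropClass β P) ≈ 0#) →
                      classSum β P ≈ 0#
      classSum-self β P powers rest-sums = begin
        classSum β P                                               ≈⟨ *-identityˡ _ ⟨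
        1# * classSum β P                                          ≈⟨ +-identityʳ _ ⟨
        1# * classSum β P + 0#                                     ≈⟨ +-congˡ rest≈0 ⟨
        1# * classSum β P + weigh (λ α → ρ α ^ 0) (dropClass β P)  ≈⟨ weigh-split (λ _ → refl) β P ⟨
        weigh (λ α → ρ α ^ 0) P                                    ≈⟨ powers 0 ⟩
        0#                                                         ∎
        where rest≈0 = weigh-classSums-zero (λ _ → refl) (dropClass β P) rest-sums

      classSums-zero-if-powerSums-zero : ∀ P → PowerSumsVanish P → ∀ γ → classSum γ P ≈ 0#
      classSums-zero-if-powerSums-zero P = go (length P) P ℕP.≤-refl
        where
        go : ∀ n P → length P ℕ.≤ n → PowerSumsVanish P → ∀ γ → classSum γ P ≈ 0#
        go n         []                _              powers γ = refl
        go (ℕ.suc n) P@((a , β) ∷ Q) (ℕ.s≤s |Q|≤n) powers γ = begin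
          classSum γ P                                             ≈⟨ weigh-split (inClass-respects γ) β P ⟩
          inClass γ β * classSum β P + classSum γ (dropClass β P)  ≈⟨ +-cong β-term≈0 (rest-sums γ) ⟩
          0# + 0#                                                  ≈⟨ +-identityʳ 0# ⟩
          0#                                                       ∎
          where
          |deflate|≤n = ℕP.≤-trans (length-deflate β Q) |Q|≤n
          rest-sums = classSums-of-deflate β P (go n (deflate β P) |deflate|≤n (deflate-powerSums β P powers))
          β-term≈0 = trans (*-congˡ (classSum-self β P powers rest-sums)) (zeroʳ _)

  module ExponentClasses = Classes (VecP.≡-dec ℕ._≟_) id

  -- Every exponent class of P - Q sums to zero, so weigh-classSums-zero applies.
  weigh-≈P : ∀ g {P Q} → P ≈P Q → weigh g P ≈ weigh g Q
  weigh-≈P g {P} {Q} P≈Q = x∙y⁻¹≈ε⇒x≈y _ _ (begin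
    weigh g P - weigh g Q       ≈⟨ +-congˡ (weigh-neg g Q) ⟨
    weigh g P + weigh g (-P Q)  ≈⟨ weigh-++ g P (-P Q) ⟨
    weigh g (P ++ -P Q)         ≈⟨ ExponentClasses.weigh-classSums-zero (reflexive ∘ ≡.cong g) (P ++ -P Q) cancel ⟩
    0#                          ∎)
    where
    cancel : ∀ γ → weigh (δ γ) (P ++ -P Q) ≈ 0#
    cancel γ = begin
      weigh (δ γ) (P ++ -P Q)             ≈⟨ weigh-++ (δ γ) P (-P Q) ⟩
      weigh (δ γ) P + weigh (δ γ) (-P Q)  ≈⟨ +-congˡ (weigh-neg (δ γ) Q) ⟩
      weigh (δ γ) P - weigh (δ γ) Q       ≈⟨ +-cong (coeff≈weigh-δ P γ) (-‿cong (coeff≈weigh-δ Q γ)) ⟨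
      coeff P γ - coeff Q γ               ≈⟨ +-congʳ (P≈Q γ) ⟩
      coeff Q γ - coeff Q γ               ≈⟨ -‿inverseʳ _ ⟩
      0#                                  ∎

  module LatticeIdeals {k} {Key : Set k} (_≟_ : DecidableEquality Key) (κ : Exp d → Key)
                       (L : ZSet d) (κ≡⇔L : ∀ α β → κ α ≡ κ β ⇔ L (expVec α β)) where
    open Classes _≟_ κ

    combination : List (Poly × Exp d × Exp d) → Poly
    combination = List.foldr (λ { (q , α , β) acc → (q *P binom α β) +P acc }) 0P

    ideal⇒weigh-zero : ∀ {g} → Respects g → Multiplicative g → ∀ P → InLatticeIdeal L P → weigh g P ≈ 0#
    ideal⇒weigh-zero {g} g-resp g-mul P (gens , gens∈L , P≈comb) =
      trans (weigh-≈P g {P} {combination gens} P≈comb) (go gens gens∈L)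
      where
      go : ∀ gens → All (λ { (q , α , β) → L (expVec α β) }) gens → weigh g (combination gens) ≈ 0#
      go []                   []                = refl
      go ((q , α , β) ∷ gens) (αβ∈L ∷ gens∈L) = begin
        weigh g ((q *P binom α β) ++ combination gens)
          ≈⟨ weigh-++ g (q *P binom α β) (combination gens) ⟩
        weigh g (q *P binom α β) + weigh g (combination gens)
          ≈⟨ +-cong (weigh-*P g-mul q (binom α β)) (go gens gens∈L) ⟩
        weigh g q * weigh g (binom α β) + 0#
          ≈⟨ +-identityʳ _ ⟩
        weigh g q * weigh g (binom α β)
          ≈⟨ *-congˡ (trans (weigh-binom g α β) binomial≈0) ⟩
        weigh g q * 0#
          ≈⟨ zeroʳ _ ⟩
        0# ∎
        where binomial≈0 = x≈y⇒x∙y⁻¹≈ε (g-resp (Equivalence.from (κ≡⇔L α β) αβ∈L))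

    representative : Poly → Exp d → Exp d
    representative []            α = α
    representative ((b , β) ∷ P) α = if does (κ β ≟ κ α) then β else representative P α

    κ-representative : ∀ P α → κ (representative P α) ≡ κ α
    κ-representative []            α = ≡.refl
    κ-representative ((b , β) ∷ P) α with κ β ≟ κ α
    ... | yes κβ≡κα = κβ≡κα
    ... | no  _     = κ-representative P α

    representative-cong : ∀ P {a α α′} → (a , α) ∈ P → κ α ≡ κ α′ →
                          representative P α ≡ representative P α′
    representative-cong ((b , β) ∷ P) {α = α} {α′} α∈P κα≡κα′ with κ β ≟ κ α | κ β ≟ κ α′
    ... | yes _     | yes _      = ≡.refl
    ... | yes κβ≡κα | no κβ≢κα′  = ⊥-elim (κβ≢κα′ (≡.trans κβ≡κα κα≡κα′))
    ... | no κβ≢κα  | yes κβ≡κα′ = ⊥-elim (κβ≢κα (≡.trans κβ≡κα′ (≡.sym κα≡κα′)))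
    ... | no κβ≢κα  | no _ with α∈P
    ...   | here ≡.refl = ⊥-elim (κβ≢κα ≡.refl)
    ...   | there α∈P′  = representative-cong P α∈P′ κα≡κα′

    -- P is the combination of the binomials aₜ (x^αₜ - x^rep(αₜ)) over its terms: the
    -- representatives rep(αₜ) are constant on each class that P meets, whose sum is zero.
    classSums-zero⇒ideal : ∀ P → (∀ γ → classSum γ P ≈ 0#) → InLatticeIdeal L P
    classSums-zero⇒ideal P sums =
      List.map generator P , AllP.map⁺ (All.universal generator∈L P) , P≈combination
      where
      rep = representative P

      generator : Carrier × Exp d → Poly × Exp d × Exp d
      generator (a , α) = ((a , 0⃗) ∷ []) , α , rep α

      generator∈L : ∀ t → L (expVec (proj₂ t) (rep (proj₂ t)))
      generator∈L (a , α) = Equivalence.to (κ≡⇔L α (rep α)) (≡.sym (κ-representative P α))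

      weigh-generators : ∀ g Q → weigh g (combination (List.map generator Q))
                                 ≈ weigh (λ α → g α - g (rep α)) Q
      weigh-generators g []            = refl
      weigh-generators g ((a , α) ∷ Q) =
        trans (weigh-++ g (((a , 0⃗) ∷ []) *P binom α (rep α)) (combination (List.map generator Q)))
              (+-cong (trans (weigh-constant-*P g a (binom α (rep α))) (*-congˡ (weigh-binom g α (rep α))))
                      (weigh-generators g Q))

      representatives-vanish : ∀ γ → weigh (δ γ ∘ rep) P ≈ 0#
      representatives-vanish γ = begin
        weigh (δ γ ∘ rep) P                        ≈⟨ weigh-cong-on P (All.tabulate on-support) ⟩
        weigh (λ α → δ γ (rep γ) * inClass γ α) P  ≈⟨ weigh-*ˡ (δ γ (rep γ)) (inClass γ) P ⟩
        δ γ (rep γ) * classSum γ P                 ≈⟨ *-congˡ (sums γ) ⟩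
        δ γ (rep γ) * 0#                           ≈⟨ zeroʳ _ ⟩
        0#                                         ∎
        where
        on-support : ∀ {t} → t ∈ P → δ γ (rep (proj₂ t)) ≈ δ γ (rep γ) * inClass γ (proj₂ t)
        on-support {a , α} t∈P with κ α ≟ κ γ
        ... | yes κα≡κγ =
          trans (reflexive (≡.cong (δ γ) (representative-cong P t∈P κα≡κγ))) (sym (*-identityʳ _))
        ... | no  κα≢κγ =
          trans (ExponentClasses.inClass-≢ λ rep≡γ →
                   κα≢κγ (≡.trans (≡.sym (κ-representative P α)) (≡.cong κ rep≡γ)))
                (sym (zeroʳ _))

      P≈combination : P ≈P combination (List.map generator P)
      P≈combination γ = begin
        coeff P γ                            ≈⟨ coeff≈weigh-δ P γ ⟩
        weigh (δ γ) P                        ≈⟨ +-identityʳ _ ⟨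
        weigh (δ γ) P + 0#                   ≈⟨ +-congˡ (trans (-‿cong (representatives-vanish γ)) ε⁻¹≈ε) ⟨
        weigh (δ γ) P - weigh (δ γ ∘ rep) P  ≈⟨ weigh-- (δ γ) (δ γ ∘ rep) P ⟨
        weigh (λ α → δ γ α - δ γ (rep α)) P  ≈⟨ weigh-generators (δ γ) P ⟨
        weigh (δ γ) combined                 ≈⟨ coeff≈weigh-δ combined γ ⟨
        coeff combined γ                     ∎
        where combined = combination (List.map generator P)

module DiagonalLoop {c ℓ} (K : CommutativeRing c ℓ) (ι : ℚ-to K)
                    (ι-hom : IsRingHomomorphism +-*-rawRing (CommutativeRing.rawRing K) ι)
                    {d} (μ : Fin d → ℚ) where
  open CommutativeRing K hiding (zero)
  open IsRingHomomorphism ι-hom using (*-homo; +-homo; -‿homo; 1#-homo)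
  open Poly K d using (powK; evalMono; eval; InLatticeIdeal)
  open Weighing K d
  open import Relation.Binary.Reasoning.Setoid setoid
  private
    ℚ-ring = ℚP.+-*-commutativeRing
    module ℚΠ = Products (CommutativeRing.commutativeSemiring ℚ-ring)
    module KΠ = Products commutativeSemiring
    open import Algebra.Properties.Group (CommutativeRing.+-group ℚ-ring)
      using () renaming (x∙y⁻¹≈ε⇒x≈y to ℚ-x-y≡0⇒x≡y)
  open ProductHomomorphism (CommutativeRing.commutativeSemiring ℚ-ring) commutativeSemiring ι 1#-homo *-homo
    using () renaming (h-^ to ι-^; h-monomial to ι-monomial)

  diagonal : QMat d
  diagonal i j = if does (i Fin.≟ j) then μ i else 0ℚ

  diagonal-isDiagonal : IsDiagonal diagonal
  diagonal-isDiagonal i j i≢j with i Fin.≟ j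
  ... | yes i≡j = ⊥-elim (i≢j i≡j)
  ... | no  _   = ≡.refl

  diagonal-diag : ∀ i → diagonal i i ≡ μ i
  diagonal-diag i with i Fin.≟ i
  ... | yes _   = ≡.refl
  ... | no  i≢i = ⊥-elim (i≢i ≡.refl)

  ones : QVec d
  ones _ = 1ℚ

  loopVal-diagonal : ∀ n i → loopVal diagonal ones n i ≡ μ i ℚΠ.^ n
  loopVal-diagonal ℕ.zero    i = ≡.refl
  loopVal-diagonal (ℕ.suc n) i =
    ≡.trans (sumFin≡foldr 0ℚ ℚ._+_ d (λ j → diagonal i j ℚ.* loopVal diagonal ones n j))
    (≡.trans (sum-supportedAt ℚP.+-0-monoid _ i off-diagonal)
             (≡.cong₂ ℚ._*_ (diagonal-diag i) (loopVal-diagonal n i)))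
    where
    off-diagonal : ∀ j → j ≢ i → diagonal i j ℚ.* loopVal diagonal ones n j ≡ 0ℚ
    off-diagonal j j≢i = ≡.trans (≡.cong (ℚ._* loopVal diagonal ones n j) (diagonal-isDiagonal i j (j≢i ∘ ≡.sym)))
                                 (ℚP.*-zeroˡ (loopVal diagonal ones n j))

  ρ : Exp d → Carrier
  ρ = KΠ.monomial (ι ∘ μ)

  powK≈^ : ∀ x n → powK x n ≈ x KΠ.^ n
  powK≈^ x ℕ.zero    = refl
  powK≈^ x (ℕ.suc n) = *-congˡ (powK≈^ x n)

  eval-loop : ∀ P n → eval P (λ i → ι (loopVal diagonal ones n i)) ≈ weigh (λ α → ρ α KΠ.^ n) P
  eval-loop P n = trans (eval≈weigh P _) (weigh-cong monomial-at-step P)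
    where
    monomial-at-step : ∀ α → evalMono α (λ i → ι (loopVal diagonal ones n i)) ≈ ρ α KΠ.^ n
    monomial-at-step α = begin
      evalMono α (λ i → ι (loopVal diagonal ones n i))
        ≡⟨ sumFin≡foldr 1# _*_ d (λ i → powK (ι (loopVal diagonal ones n i)) (lookup α i)) ⟩
      KΠ.∏ (λ i → powK (ι (loopVal diagonal ones n i)) (lookup α i))
        ≈⟨ KΠ.∏-cong (λ i → trans (powK≈^ _ (lookup α i)) (KΠ.^-congˡ (lookup α i) (ι-loopVal i))) ⟩
      KΠ.monomial (λ i → ι (μ i) KΠ.^ n) α
        ≈⟨ KΠ.monomial-^ (ι ∘ μ) n α ⟩
      ρ α KΠ.^ n ∎
      where
      ι-loopVal : ∀ i → ι (loopVal diagonal ones n i) ≈ ι (μ i) KΠ.^ n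
      ι-loopVal i = trans (reflexive (≡.cong ι (loopVal-diagonal n i))) (ι-^ (μ i) n)

  ι-cancellable : ∀ q → q ≢ 0ℚ → Cancellable (ι q)
  ι-cancellable q q≢0 y ιq*y≈0 = begin
    y                        ≈⟨ *-identityˡ y ⟨
    1# * y                   ≈⟨ *-congʳ (trans (reflexive (≡.cong ι (ℚP.*-inverseˡ q))) 1#-homo) ⟨
    ι (ℚ.1/ q ℚ.* q) * y     ≈⟨ *-congʳ (*-homo (ℚ.1/ q) q) ⟩
    (ι (ℚ.1/ q) * ι q) * y   ≈⟨ *-assoc _ _ _ ⟩
    ι (ℚ.1/ q) * (ι q * y)   ≈⟨ *-congˡ ιq*y≈0 ⟩
    ι (ℚ.1/ q) * 0#          ≈⟨ zeroʳ _ ⟩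
    0#                       ∎
    where instance _ = ℚ.≢-nonZero q≢0

  open Classes ℚ._≟_ (ℚΠ.monomial μ)

  ρ-respects : Respects ρ
  ρ-respects {α} {β} eq = trans (sym (ι-monomial μ α)) (trans (reflexive (≡.cong ι eq)) (ι-monomial μ β))

  ρ-separates : ∀ {α β} → ℚΠ.monomial μ α ≢ ℚΠ.monomial μ β → Cancellable (ρ α - ρ β)
  ρ-separates {α} {β} μα≢μβ y difference*y≈0 =
    ι-cancellable (ℚΠ.monomial μ α ℚ.- ℚΠ.monomial μ β) (μα≢μβ ∘ ℚ-x-y≡0⇒x≡y _ _) y
                  (trans (*-congʳ ι-difference) difference*y≈0)
    where
    ι-difference : ι (ℚΠ.monomial μ α ℚ.- ℚΠ.monomial μ β) ≈ ρ α - ρ β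
    ι-difference = trans (+-homo _ _) (+-cong (ι-monomial μ α) (trans (-‿homo _) (-‿cong (ι-monomial μ β))))

  ρ^-multiplicative : ∀ n → Multiplicative (λ α → ρ α KΠ.^ n)
  ρ^-multiplicative n α β = trans (KΠ.^-congˡ n (KΠ.monomial-+ (ι ∘ μ) α β)) (KΠ.^-distrib-* (ρ α) (ρ β) n)

  open PowerSums (λ {α β} → ρ-respects {α} {β}) (λ {α β} → ρ-separates {α} {β})

  diagonalLoop-invariantIdeal : ∀ (L : ZSet d) →
    (∀ α β → ℚΠ.monomial μ α ≡ ℚΠ.monomial μ β ⇔ L (expVec α β)) →
    Loop.InvIdealIs K d ι ones diagonal L
  diagonalLoop-invariantIdeal L μ-separates P = mk⇔ invariant⇒ideal ideal⇒invariant
    where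
    open LatticeIdeals ℚ._≟_ (ℚΠ.monomial μ) L μ-separates

    invariant⇒ideal : Loop.IsInvariant K d ι ones diagonal P → InLatticeIdeal L P
    invariant⇒ideal invariant =
      classSums-zero⇒ideal P
        (classSums-zero-if-powerSums-zero P (λ n → trans (sym (eval-loop P n)) (invariant n)))

    ideal⇒invariant : InLatticeIdeal L P → Loop.IsInvariant K d ι ones diagonal P
    ideal⇒invariant P∈I n =
      trans (eval-loop P n)
            (ideal⇒weigh-zero (λ {α β} eq → KΠ.^-congˡ n (ρ-respects {α} {β} eq)) (ρ^-multiplicative n) P P∈I)

theorem3p7 : ∀ {c ℓ} (K : CommutativeRing c ℓ) → IsField K → IsAlgClosed K →
    (ι : ℚ-to K) → IsRingHomomorphism +-*-rawRing (CommutativeRing.rawRing K) ι →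
    (d k : ℕ) (α β : Fin k → Exp d) →
    Σ (QVec d) λ s → Σ (QMat d) λ M →
      IsDiagonal M ×
      Loop.InvIdealIs K d ι s M (Sat (Span k (λ i → expVec (α i) (β i))))
theorem3p7 K _ _ ι ι-hom d k α β with SaturationKernel.saturation-kernel k (λ i → expVec (α i) (β i))
... | m , A , kernel⇔saturation =
  ones , diagonal , diagonal-isDiagonal , diagonalLoop-invariantIdeal L eigenvalues-separate
  where
  L = Sat (Span k (λ i → expVec (α i) (β i)))
  open RationalEigenvalues.Eigenvalues A using (eigenvalue; monomial-eigenvalue-≡⇔)
  open DiagonalLoop K ι ι-hom eigenvalue
  open Products (CommutativeRing.commutativeSemiring ℚP.+-*-commutativeRing) using (monomial)
  eigenvalues-separate : ∀ γ₁ γ₂ → monomial eigenvalue γ₁ ≡ monomial eigenvalue γ₂ ⇔ L (expVec γ₁ γ₂)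
  eigenvalues-separate γ₁ γ₂ =
    ⇔-trans (monomial-eigenvalue-≡⇔ γ₁ γ₂)
            (⇔-trans (IntegerMatrices.Ker-expVec⇔ A γ₁ γ₂) (kernel⇔saturation (expVec γ₁ γ₂)))
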